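{- There is no poset $P$ of height $2$ with $e(P)=(10!)^2-1=13168189439999$.
   Context: A poset has height $2$ if every chain has at most two elements. $e(P)$ denotes the number of linear extensions of a finite poset $P$ (bijections $\ell:X\to[|X|]$ with $\ell(x)<\ell(y)$ whenever $x\prec y$). -}

module Defs where

open import Data.Nat using (ℕ; zero; suc; _<_)
open import Data.Nat.Properties using (_<?_)
open import Data.Bool using (Bool; true; false; T; _∧_)
open import Data.Fin using (Fin; toℕ)
open import Data.Fin.Properties using (all?)
open import Data.Vec using (Vec; []; _∷_; lookup)
open import Data.List using (List; []; _∷_; map; concatMap; filter; length)
open import Data.Product using (_×_)
open import Relation.Nullary using (¬_; Dec)
open import Relation.Nullary.Decidable using (⌊_⌋; _→-dec_)
open import Relation.Binary.PropositionalEquality using (_≡_)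
open import Data.Fin.Properties using (_≟_)

record IsStrictPoset (n : ℕ) (lt : Fin n → Fin n → Bool) : Set where
  field
    irrefl : ∀ x → ¬ T (lt x x)
    trans  : ∀ x y z → T (lt x y) → T (lt y z) → T (lt x z)

HeightAtMost2 : (n : ℕ) → (Fin n → Fin n → Bool) → Set
HeightAtMost2 n lt = ∀ x y z → T (lt x y) → ¬ T (lt y z)

-- all maps Fin n → Fin m, as vectors of length k (here k = n)
allVecs : (m k : ℕ) → List (Vec (Fin m) k)
allVecs m zero = [] ∷ []
allVecs m (suc k) =
  concatMap (λ v → map (λ i → i ∷ v) (Data.List.allFin m)) (allVecs m k)
  where import Data.List

-- ℓ : Fin n → Fin n (given as a vector of labels) is injective, hence a bijection
IsInjective : {n : ℕ} → Vec (Fin n) n → Set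
IsInjective {n} ℓ = ∀ x y → lookup ℓ x ≡ lookup ℓ y → x ≡ y

injective? : {n : ℕ} → (ℓ : Vec (Fin n) n) → Dec (IsInjective ℓ)
injective? ℓ = all? λ x → all? λ y → (lookup ℓ x ≟ lookup ℓ y) →-dec (x ≟ y)

IsOrderPreserving : {n : ℕ} → (Fin n → Fin n → Bool) → Vec (Fin n) n → Set
IsOrderPreserving lt ℓ = ∀ x y → T (lt x y) → toℕ (lookup ℓ x) < toℕ (lookup ℓ y)

orderPreserving? : {n : ℕ} → (lt : Fin n → Fin n → Bool) → (ℓ : Vec (Fin n) n) →
                   Dec (IsOrderPreserving lt ℓ)
orderPreserving? lt ℓ = all? λ x → all? λ y →
  Data.Bool.Properties.T? (lt x y) →-dec (toℕ (lookup ℓ x) <? toℕ (lookup ℓ y))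
  where import Data.Bool.Properties

isLinearExtension : {n : ℕ} → (Fin n → Fin n → Bool) → Vec (Fin n) n → Bool
isLinearExtension lt ℓ = ⌊ injective? ℓ ⌋ ∧ ⌊ orderPreserving? lt ℓ ⌋

-- e(P): number of linear extensions (bijections ℓ : X → [|X|], labels 0..n-1)
numLinExt : (n : ℕ) → (Fin n → Fin n → Bool) → ℕ
numLinExt n lt = length (filter (λ ℓ → T? (isLinearExtension lt ℓ)) (allVecs n n))
  where open import Data.Bool.Properties using (T?)

{-# OPTIONS --safe #-}
-- Let E = (10!)² − 1, which is odd, and count linear extensions recursively by their first,
-- necessarily minimal, element.  If n ≥ 20, the a minimal elements and the remaining n − a
-- elements are antichains (height 2), so e(P) ≥ a! (n − a)! ≥ (10!)² > E.  If n ≤ 15, then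
-- e(P) ≤ n! < E.  An isolated element gives e(P) = n · e(P − w), and no n in 16..19 divides E.
-- Otherwise every element is comparable to another one.  Expanding the recursion two steps, the
-- terms where both first elements are minimal cancel in pairs modulo 2, leaving the pairs x ≺ y
-- in which x is the only element below y.  For odd n, every row of that sum is even: one such y
-- leaves a smaller instance, two give equal terms, three or more leave two isolated elements.
-- For even n, an odd e(P) yields n/2 disjoint comparable pairs, each halving the bound n!, and
-- n! / 2^(n/2) < E for the even n < 20.
module Submission where

open import Defs
open import Data.Nat using (ℕ; _∸_; _*_; _!)
open import Data.Fin using (Fin)
open import Data.Bool using (Bool)
open import Relation.Nullary using (¬_)
open import Relation.Binary.PropositionalEquality using (_≡_)

open import Data.Nat using (zero; suc; _+_; _^_; _≤_; _<_; z≤n; s≤s; parity; ⌊_/2⌋)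
open import Data.Nat.Properties hiding (_≟_)
open import Data.Nat.Properties using () renaming (_≟_ to _≡ᵈ_)
open import Data.Nat.Divisibility using (_∣_; _∣?_; ∣⇒≤; m∣m*n; m≤n⇒m!∣n!)
open import Data.Nat.Tactic.RingSolver using (solve-∀)
open import Data.Fin using (zero; suc; toℕ; punchOut)
open import Data.Fin.Properties using (_≟_; any?; pigeonhole; punchOut-injective)
import Data.Fin.Properties as Fin
open import Data.Bool using (true; false; _∧_; _∨_; not; T)
open import Data.Bool.Properties
  using (T?; T-≡; T-∨; ¬-not; not-injective; ∧-conicalˡ; ∧-conicalʳ; ∧-comm; ∧-zeroʳ; ∧-identityʳ;
         ∨-conicalˡ; ∨-conicalʳ)
  renaming (_≟_ to _≟ᵇ_)
open import Data.Parity using (0ℙ; 1ℙ)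
import Data.Parity as ℙ
open import Data.Parity.Properties using (+-homo-+; *-homo-*; p+p≡0ℙ; suc-homo-⁻¹; ⁻¹-involutive)
import Data.Parity.Properties as ℙ
open import Data.Product using (∃; ∃₂; _×_; _,_; proj₁; proj₂)
open import Data.Sum using (_⊎_; inj₁; inj₂; [_,_]′) renaming (map to ⊎-map)
open import Data.Empty using (⊥; ⊥-elim)
open import Data.List using (List; []; _∷_; _++_; map; concatMap; allFin; length; filter)
  renaming (tabulate to tabulateᴸ)
open import Data.Vec using (Vec; []; _∷_; lookup; tabulate)
open import Data.Vec.Properties using (≡-dec; lookup∘tabulate; tabulate∘lookup; tabulate-cong)
open import Function using (_∘_; id; Equivalence)
open import Relation.Nullary using (Dec; yes; no; does)
open import Relation.Nullary.Decidable
  using (⌊_⌋; dec-true; dec-false; toWitness; fromWitness; from-yes; ¬?; _→-dec_; _⊎-dec_)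
open import Relation.Binary.Definitions using (DecidableEquality)
open import Relation.Binary.PropositionalEquality
  using (refl; sym; trans; cong; cong₂; subst; subst₂; _≢_; _≗_; module ≡-Reasoning)
open import Algebra.Properties.CommutativeSemigroup +-commutativeSemigroup using (interchange)
open import Algebra.Properties.CommutativeSemigroup *-commutativeSemigroup using (x∙yz≈y∙xz)
open import Algebra.Properties.Semiring.Sum +-*-semiring
  using (sum; sum-cong-≗; ∑-distrib-+; *-distribˡ-sum; sum-replicate-zero)

private variable
  m n : ℕ
  A B : Set

𝟙 : Bool → ℕ
𝟙 true = 1
𝟙 false = 0

𝟙-∧ : ∀ a b → 𝟙 (a ∧ b) ≡ 𝟙 a * 𝟙 b
𝟙-∧ true b = sym (+-identityʳ (𝟙 b))
𝟙-∧ false b = refl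

𝟙-mono : ∀ {a b} → (a ≡ true → b ≡ true) → 𝟙 a ≤ 𝟙 b
𝟙-mono {false} _ = z≤n
𝟙-mono {true} a⇒b rewrite a⇒b refl = ≤-refl

𝟙*-≤ : ∀ b X → 𝟙 b * X ≤ X
𝟙*-≤ true X = ≤-reflexive (*-identityˡ X)
𝟙*-≤ false X = z≤n

𝟙*𝟙* : ∀ a b X → 𝟙 a * (𝟙 b * X) ≡ 𝟙 (b ∧ a) * X
𝟙*𝟙* a true X = cong (𝟙 a *_) (*-identityˡ X)
𝟙*𝟙* a false X = *-zeroʳ (𝟙 a)

𝟙*-mono : ∀ {a b X Y} → (a ≡ true → b ≡ true × X ≤ Y) → 𝟙 a * X ≤ 𝟙 b * Y
𝟙*-mono {false} _ = z≤n
𝟙*-mono {true} h with h refl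
... | refl , X≤Y = +-monoˡ-≤ 0 X≤Y

𝟙*-cong : ∀ {a b X Y} → a ≡ b → (a ≡ true → X ≡ Y) → 𝟙 a * X ≡ 𝟙 b * Y
𝟙*-cong {false} refl _ = refl
𝟙*-cong {true} refl h = cong (_+ 0) (h refl)

does⇒ : ∀ {P : Set} (d : Dec P) → does d ≡ true → P
does⇒ (yes p) _ = p

T⇒≡true : ∀ {b} → T b → b ≡ true
T⇒≡true = Equivalence.to T-≡

≡true⇒T : ∀ {b} → b ≡ true → T b
≡true⇒T = Equivalence.from T-≡

𝟙-by-cases : ∀ a b l → (l ≡ true → b ≡ false) → (l ≡ false → b ≡ a) → 𝟙 a ≡ 𝟙 b + 𝟙 (l ∧ a)
𝟙-by-cases a b true b≡false _ rewrite b≡false refl = refl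
𝟙-by-cases a b false _ b≡a rewrite b≡a refl = sym (+-identityʳ (𝟙 a))

true≢false : true ≢ false
true≢false ()

bool-ext : ∀ {a b} → (a ≡ true → b ≡ true) → (b ≡ true → a ≡ true) → a ≡ b
bool-ext {true} a⇒b _ = sym (a⇒b refl)
bool-ext {false} {true} _ b⇒a = b⇒a refl
bool-ext {false} {false} _ _ = refl

allᵇ : (Fin m → Bool) → Bool
allᵇ {zero} p = true
allᵇ {suc m} p = p zero ∧ allᵇ (p ∘ suc)

allᵇ-elim : {p : Fin m → Bool} → allᵇ p ≡ true → ∀ x → p x ≡ true
allᵇ-elim {suc m} {p} e zero = ∧-conicalˡ (p zero) _ e
allᵇ-elim {suc m} {p} e (suc x) = allᵇ-elim (∧-conicalʳ (p zero) _ e) x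

allᵇ-intro : {p : Fin m → Bool} → (∀ x → p x ≡ true) → allᵇ p ≡ true
allᵇ-intro {zero} h = refl
allᵇ-intro {suc m} h = cong₂ _∧_ (h zero) (allᵇ-intro (h ∘ suc))

allᵇ-cong : {p q : Fin m → Bool} → (∀ x → p x ≡ q x) → allᵇ p ≡ allᵇ q
allᵇ-cong {zero} h = refl
allᵇ-cong {suc m} h = cong₂ _∧_ (h zero) (allᵇ-cong (h ∘ suc))

find : (p : Fin m → Bool) → (∃ λ x → p x ≡ true) ⊎ (∀ x → p x ≡ false)
find p with any? (λ x → p x ≟ᵇ true)
... | yes found = inj₁ found
... | no none = inj₂ λ x → ¬-not (λ px → none (x , px))

allᵇ-counterexample : {p : Fin m → Bool} → allᵇ p ≡ false → ∃ λ x → p x ≡ false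
allᵇ-counterexample {p = p} e with find (not ∘ p)
... | inj₁ (x , px) = x , not-injective px
... | inj₂ none = ⊥-elim (true≢false (trans (sym (allᵇ-intro (not-injective ∘ none))) e))

sum-mono-≤ : {f g : Fin n → ℕ} → (∀ i → f i ≤ g i) → sum f ≤ sum g
sum-mono-≤ {zero} le = z≤n
sum-mono-≤ {suc n} le = +-mono-≤ (le zero) (sum-mono-≤ (le ∘ suc))

sum≡0⇒≡0 : (f : Fin n → ℕ) → sum f ≡ 0 → ∀ i → f i ≡ 0
sum≡0⇒≡0 {suc n} f e zero = m+n≡0⇒m≡0 (f zero) e
sum≡0⇒≡0 {suc n} f e (suc i) = sum≡0⇒≡0 (f ∘ suc) (m+n≡0⇒n≡0 (f zero) e) i

sum-*ˡ : ∀ c (f : Fin n → ℕ) → sum (λ i → c * f i) ≡ c * sum f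
sum-*ˡ c f = sym (*-distribˡ-sum c f)

sum-𝟙-≡ : ∀ (x : Fin n) (f : Fin n → ℕ) → sum (λ i → 𝟙 (does (i ≟ x)) * f i) ≡ f x
sum-𝟙-≡ {suc n} zero f = begin
  (f zero + 0) + sum {n} (λ _ → 0) ≡⟨ cong₂ _+_ (+-identityʳ (f zero)) (sum-replicate-zero n) ⟩
  f zero + 0                   ≡⟨ +-identityʳ (f zero) ⟩
  f zero                       ∎
  where open ≡-Reasoning
sum-𝟙-≡ {suc n} (suc x) f = sum-𝟙-≡ {n} x (f ∘ suc)

sum-split : ∀ (x : Fin n) (f : Fin n → ℕ) → sum f ≡ f x + sum (λ i → 𝟙 (not (does (i ≟ x))) * f i)
sum-split x f = begin
  sum f
    ≡⟨ sum-cong-≗ (λ i → split (i ≟ x) (f i)) ⟩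
  sum (λ i → 𝟙 (does (i ≟ x)) * f i + 𝟙 (not (does (i ≟ x))) * f i)
    ≡⟨ ∑-distrib-+ (λ i → 𝟙 (does (i ≟ x)) * f i) _ ⟩
  sum (λ i → 𝟙 (does (i ≟ x)) * f i) + sum (λ i → 𝟙 (not (does (i ≟ x))) * f i)
    ≡⟨ cong (_+ sum (λ i → 𝟙 (not (does (i ≟ x))) * f i)) (sum-𝟙-≡ x f) ⟩
  f x + sum (λ i → 𝟙 (not (does (i ≟ x))) * f i) ∎
  where
  open ≡-Reasoning
  split : ∀ {A : Set} (d : Dec A) X → X ≡ 𝟙 (does d) * X + 𝟙 (not (does d)) * X
  split (yes _) X = sym (trans (+-identityʳ (X + 0)) (+-identityʳ X))
  split (no _) X = sym (+-identityʳ X)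

parity-sum-even : (f : Fin n → ℕ) → (∀ i → parity (f i) ≡ 0ℙ) → parity (sum f) ≡ 0ℙ
parity-sum-even {zero} f h = refl
parity-sum-even {suc n} f h = begin
  parity (f zero + sum (f ∘ suc))               ≡⟨ +-homo-+ (f zero) _ ⟩
  parity (f zero) ℙ.+ parity (sum (f ∘ suc))   ≡⟨ cong₂ ℙ._+_ (h zero) (parity-sum-even (f ∘ suc) (h ∘ suc)) ⟩
  0ℙ                                            ∎
  where open ≡-Reasoning

parity-sum-odd : (f : Fin n → ℕ) → parity (sum f) ≡ 1ℙ → ∃ λ i → parity (f i) ≡ 1ℙ
parity-sum-odd {suc n} f odd with parity (f zero) in p0
... | 1ℙ = zero , p0
... | 0ℙ with parity-sum-odd (f ∘ suc) (trans (cong (ℙ._+ parity (sum (f ∘ suc))) (sym p0))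
                                              (trans (sym (+-homo-+ (f zero) (sum (f ∘ suc)))) odd))
... | i , pi = suc i , pi

parity-double : ∀ m → parity (m + m) ≡ 0ℙ
parity-double m = trans (+-homo-+ m m) (p+p≡0ℙ (parity m))

parity-𝟙*-odd : ∀ b X → parity (𝟙 b * X) ≡ 1ℙ → b ≡ true × parity X ≡ 1ℙ
parity-𝟙*-odd true X odd = refl , trans (cong parity (sym (+-identityʳ X))) odd

parity-𝟙*-even : ∀ b X → (b ≡ true → parity X ≡ 0ℙ) → parity (𝟙 b * X) ≡ 0ℙ
parity-𝟙*-even true X even = trans (cong parity (+-identityʳ X)) (even refl)
parity-𝟙*-even false X _ = refl

parity-consecutive : ∀ k → parity (suc k * k) ≡ 0ℙ
parity-consecutive zero = refl
parity-consecutive (suc k) = begin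
  parity (suc (suc k) * suc k)       ≡⟨ *-homo-* (suc (suc k)) (suc k) ⟩
  parity k ℙ.* parity (suc k)        ≡⟨ ℙ.*-comm (parity k) _ ⟩
  parity (suc k) ℙ.* parity k        ≡⟨ sym (*-homo-* (suc k) k) ⟩
  parity (suc k * k)                 ≡⟨ parity-consecutive k ⟩
  0ℙ                                 ∎
  where open ≡-Reasoning

parity-consecutive-* : ∀ k X → parity (suc (suc k) * (suc k * X)) ≡ 0ℙ
parity-consecutive-* k X = begin
  parity (suc (suc k) * (suc k * X))          ≡⟨ cong parity (*-assoc (suc (suc k)) (suc k) X) ⟨
  parity ((suc (suc k) * suc k) * X)          ≡⟨ *-homo-* (suc (suc k) * suc k) X ⟩
  parity (suc (suc k) * suc k) ℙ.* parity X   ≡⟨ cong (ℙ._* parity X) (parity-consecutive (suc k)) ⟩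
  0ℙ                                          ∎
  where open ≡-Reasoning

-- A symmetric double sum with zero diagonal counts every off-diagonal term twice.
parity-symmetric-sum : (g : Fin n → Fin n → ℕ) → (∀ x y → g x y ≡ g y x) → (∀ x → g x x ≡ 0) →
  parity (sum (λ x → sum (g x))) ≡ 0ℙ
parity-symmetric-sum {zero} g sym-g diag = refl
parity-symmetric-sum {suc n} g sym-g diag = begin
  parity ((g zero zero + R) + sum (λ x → g (suc x) zero + sum (λ y → g (suc x) (suc y))))
    ≡⟨ cong (λ t → parity ((t + R) + sum (λ x → g (suc x) zero + sum (λ y → g (suc x) (suc y))))) (diag zero) ⟩
  parity (R + sum (λ x → g (suc x) zero + sum (λ y → g (suc x) (suc y))))
    ≡⟨ cong (λ t → parity (R + t)) (∑-distrib-+ (λ x → g (suc x) zero) _) ⟩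
  parity (R + (sum (λ x → g (suc x) zero) + Q))
    ≡⟨ cong (λ t → parity (R + (t + Q))) (sum-cong-≗ (λ x → sym-g (suc x) zero)) ⟩
  parity (R + (R + Q))
    ≡⟨ cong parity (sym (+-assoc R R Q)) ⟩
  parity ((R + R) + Q)
    ≡⟨ +-homo-+ (R + R) Q ⟩
  parity (R + R) ℙ.+ parity Q
    ≡⟨ cong₂ ℙ._+_ (parity-double R)
         (parity-symmetric-sum (λ x y → g (suc x) (suc y)) (λ x y → sym-g (suc x) (suc y)) (diag ∘ suc)) ⟩
  0ℙ ∎
  where
  open ≡-Reasoning
  R = sum (λ y → g zero (suc y))
  Q = sum (λ x → sum (λ y → g (suc x) (suc y)))

∑ᴸ : List A → (A → ℕ) → ℕ
∑ᴸ [] f = 0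
∑ᴸ (x ∷ xs) f = f x + ∑ᴸ xs f

∑ᴸ-cong : ∀ (xs : List A) {f g : A → ℕ} → (∀ a → f a ≡ g a) → ∑ᴸ xs f ≡ ∑ᴸ xs g
∑ᴸ-cong [] e = refl
∑ᴸ-cong (x ∷ xs) e = cong₂ _+_ (e x) (∑ᴸ-cong xs e)

∑ᴸ-++ : ∀ (xs ys : List A) (f : A → ℕ) → ∑ᴸ (xs ++ ys) f ≡ ∑ᴸ xs f + ∑ᴸ ys f
∑ᴸ-++ [] ys f = refl
∑ᴸ-++ (x ∷ xs) ys f = trans (cong (f x +_) (∑ᴸ-++ xs ys f)) (sym (+-assoc (f x) _ _))

∑ᴸ-map : (h : A → B) (xs : List A) (f : B → ℕ) → ∑ᴸ (map h xs) f ≡ ∑ᴸ xs (f ∘ h)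
∑ᴸ-map h [] f = refl
∑ᴸ-map h (x ∷ xs) f = cong (f (h x) +_) (∑ᴸ-map h xs f)

∑ᴸ-concatMap : (F : A → List B) (xs : List A) (f : B → ℕ) →
  ∑ᴸ (concatMap F xs) f ≡ ∑ᴸ xs (λ a → ∑ᴸ (F a) f)
∑ᴸ-concatMap F [] f = refl
∑ᴸ-concatMap F (x ∷ xs) f =
  trans (∑ᴸ-++ (F x) (concatMap F xs) f) (cong (∑ᴸ (F x) f +_) (∑ᴸ-concatMap F xs f))

∑ᴸ-*ˡ : ∀ (xs : List A) c (f : A → ℕ) → ∑ᴸ xs (λ a → c * f a) ≡ c * ∑ᴸ xs f
∑ᴸ-*ˡ [] c f = sym (*-zeroʳ c)
∑ᴸ-*ˡ (x ∷ xs) c f = trans (cong (c * f x +_) (∑ᴸ-*ˡ xs c f)) (sym (*-distribˡ-+ c (f x) _))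

∑ᴸ-sum-comm : ∀ (xs : List A) (h : Fin n → A → ℕ) →
  ∑ᴸ xs (λ a → sum (λ i → h i a)) ≡ sum (λ i → ∑ᴸ xs (h i))
∑ᴸ-sum-comm {n = n} [] h = sym (sum-replicate-zero n)
∑ᴸ-sum-comm (x ∷ xs) h =
  trans (cong (sum (λ i → h i x) +_) (∑ᴸ-sum-comm xs h)) (sym (∑-distrib-+ (λ i → h i x) _))

∑ᴸ-comm : (xs : List A) (ys : List B) (g : A → B → ℕ) →
  ∑ᴸ xs (λ a → ∑ᴸ ys (g a)) ≡ ∑ᴸ ys (λ b → ∑ᴸ xs (λ a → g a b))
∑ᴸ-comm [] ys g = sym (zeros ys)
  where
  zeros : (ys : List B) → ∑ᴸ ys (λ _ → 0) ≡ 0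
  zeros [] = refl
  zeros (y ∷ ys) = zeros ys
∑ᴸ-comm (x ∷ xs) ys g = trans (cong (∑ᴸ ys (g x) +_) (∑ᴸ-comm xs ys g)) (sym (+-distrib ys))
  where
  +-distrib : ∀ ys → ∑ᴸ ys (λ b → g x b + ∑ᴸ xs (λ a → g a b)) ≡ ∑ᴸ ys (g x) + ∑ᴸ ys (λ b → ∑ᴸ xs (λ a → g a b))
  +-distrib [] = refl
  +-distrib (y ∷ ys) rewrite +-distrib ys = interchange (g x y) _ _ _

length-filter : ∀ (b : A → Bool) (xs : List A) → length (filter (T? ∘ b) xs) ≡ ∑ᴸ xs (𝟙 ∘ b)
length-filter b [] = refl
length-filter b (x ∷ xs) with b x
... | true = cong suc (length-filter b xs)
... | false = length-filter b xs

∑ᴸ-tabulate : (h : Fin n → A) (f : A → ℕ) → ∑ᴸ (tabulateᴸ h) f ≡ sum (f ∘ h)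
∑ᴸ-tabulate {n = zero} h f = refl
∑ᴸ-tabulate {n = suc n} h f = cong (f (h zero) +_) (∑ᴸ-tabulate (h ∘ suc) f)

module DoubleCounting (_≟ᴬ_ : DecidableEquality A) (xs : List A)
  (unique : ∀ w → ∑ᴸ xs (λ v → 𝟙 (does (v ≟ᴬ w))) ≡ 1) where

  count-via-fibres : (c : A → Bool) (φ : A → A) →
    ∑ᴸ xs (𝟙 ∘ c) ≡ ∑ᴸ xs (λ a → ∑ᴸ xs (λ b → 𝟙 (c a ∧ does (b ≟ᴬ φ a))))
  count-via-fibres c φ = ∑ᴸ-cong xs λ a → begin
    𝟙 (c a)                                     ≡⟨ sym (*-identityʳ _) ⟩
    𝟙 (c a) * 1                                 ≡⟨ cong (𝟙 (c a) *_) (sym (unique (φ a))) ⟩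
    𝟙 (c a) * ∑ᴸ xs (λ b → 𝟙 (does (b ≟ᴬ φ a))) ≡⟨ sym (∑ᴸ-*ˡ xs (𝟙 (c a)) (λ b → 𝟙 (does (b ≟ᴬ φ a)))) ⟩
    ∑ᴸ xs (λ b → 𝟙 (c a) * 𝟙 (does (b ≟ᴬ φ a))) ≡⟨ ∑ᴸ-cong xs (λ b → sym (𝟙-∧ (c a) _)) ⟩
    ∑ᴸ xs (λ b → 𝟙 (c a ∧ does (b ≟ᴬ φ a)))     ∎
    where open ≡-Reasoning

  count-bijection : (p q : A → Bool) (φ ψ : A → A) →
    (∀ a b → (p a ∧ does (b ≟ᴬ φ a)) ≡ (q b ∧ does (a ≟ᴬ ψ b))) →
    ∑ᴸ xs (𝟙 ∘ p) ≡ ∑ᴸ xs (𝟙 ∘ q)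
  count-bijection p q φ ψ graph = begin
    ∑ᴸ xs (𝟙 ∘ p)                                         ≡⟨ count-via-fibres p φ ⟩
    ∑ᴸ xs (λ a → ∑ᴸ xs (λ b → 𝟙 (p a ∧ does (b ≟ᴬ φ a)))) ≡⟨ ∑ᴸ-cong xs (λ a → ∑ᴸ-cong xs (cong 𝟙 ∘ graph a)) ⟩
    ∑ᴸ xs (λ a → ∑ᴸ xs (λ b → 𝟙 (q b ∧ does (a ≟ᴬ ψ b)))) ≡⟨ ∑ᴸ-comm xs xs _ ⟩
    ∑ᴸ xs (λ b → ∑ᴸ xs (λ a → 𝟙 (q b ∧ does (a ≟ᴬ ψ b)))) ≡⟨ sym (count-via-fibres q ψ) ⟩
    ∑ᴸ xs (𝟙 ∘ q)                                         ∎
    where open ≡-Reasoning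

_≟ᵛ_ : ∀ {k} → DecidableEquality (Vec (Fin m) k)
_≟ᵛ_ = ≡-dec _≟_

∑-allVecs-suc : ∀ k (f : Vec (Fin m) (suc k) → ℕ) →
  ∑ᴸ (allVecs m (suc k)) f ≡ sum (λ i → ∑ᴸ (allVecs m k) (λ v → f (i ∷ v)))
∑-allVecs-suc {m} k f = begin
  ∑ᴸ (allVecs m (suc k)) f
    ≡⟨ ∑ᴸ-concatMap (λ v → map (_∷ v) (allFin m)) (allVecs m k) f ⟩
  ∑ᴸ (allVecs m k) (λ v → ∑ᴸ (map (_∷ v) (allFin m)) f)
    ≡⟨ ∑ᴸ-cong (allVecs m k) (λ v → trans (∑ᴸ-map (_∷ v) (allFin m) f) (∑ᴸ-tabulate id (f ∘ (_∷ v)))) ⟩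
  ∑ᴸ (allVecs m k) (λ v → sum (λ i → f (i ∷ v)))
    ≡⟨ ∑ᴸ-sum-comm (allVecs m k) (λ i v → f (i ∷ v)) ⟩
  sum (λ i → ∑ᴸ (allVecs m k) (λ v → f (i ∷ v))) ∎
  where open ≡-Reasoning

allVecs-unique : ∀ k (w : Vec (Fin m) k) → ∑ᴸ (allVecs m k) (λ v → 𝟙 (does (v ≟ᵛ w))) ≡ 1
allVecs-unique zero [] = refl
allVecs-unique {m} (suc k) (b ∷ w) = begin
  ∑ᴸ (allVecs m (suc k)) (λ v → 𝟙 (does (v ≟ᵛ (b ∷ w))))
    ≡⟨ ∑-allVecs-suc k _ ⟩
  sum (λ i → ∑ᴸ (allVecs m k) (λ v → 𝟙 (does (i ≟ b) ∧ does (v ≟ᵛ w))))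
    ≡⟨ sum-cong-≗ (λ i → trans (∑ᴸ-cong (allVecs m k) (λ v → 𝟙-∧ (does (i ≟ b)) _))
                              (∑ᴸ-*ˡ (allVecs m k) (𝟙 (does (i ≟ b))) (λ v → 𝟙 (does (v ≟ᵛ w))))) ⟩
  sum (λ i → 𝟙 (does (i ≟ b)) * ∑ᴸ (allVecs m k) (λ v → 𝟙 (does (v ≟ᵛ w))))
    ≡⟨ sum-cong-≗ (λ i → cong (𝟙 (does (i ≟ b)) *_) (allVecs-unique k w)) ⟩
  sum (λ i → 𝟙 (does (i ≟ b)) * 1)
    ≡⟨ sum-𝟙-≡ b (λ _ → 1) ⟩
  1 ∎
  where open ≡-Reasoning

Subset : ℕ → Set
Subset n = Fin n → Bool

infix 4 _∈_
_∈_ : Fin n → Subset n → Set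
x ∈ S = S x ≡ true

infixl 6 _─_
_─_ : Subset n → Fin n → Subset n
(S ─ x) y = S y ∧ not (does (y ≟ x))

∣_∣ : Subset n → ℕ
∣ S ∣ = sum (𝟙 ∘ S)

─-cong : ∀ {S T : Subset n} → S ≗ T → ∀ x → S ─ x ≗ T ─ x
─-cong S≗T x y = cong (_∧ not (does (y ≟ x))) (S≗T y)

─-comm : ∀ (S : Subset n) x y → S ─ x ─ y ≗ S ─ y ─ x
─-comm S x y z with S z
... | true = ∧-comm (not (does (z ≟ x))) _
... | false = refl

module _ (S : Subset n) (x : Fin n) where

  ∈-─⁻ : ∀ {y} → y ∈ S ─ x → y ∈ S
  ∈-─⁻ {y} = ∧-conicalˡ (S y) _

  ∈-─⇒≢ : ∀ {y} → y ∈ S ─ x → y ≢ x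
  ∈-─⇒≢ {y} y∈ refl = true≢false (trans (sym y∈)
    (trans (cong (λ b → S y ∧ not b) (dec-true (y ≟ y) refl)) (∧-zeroʳ (S y))))

  ─-≢ : ∀ {y} → y ≢ x → (S ─ x) y ≡ S y
  ─-≢ {y} y≢x = trans (cong (λ b → S y ∧ not b) (dec-false (y ≟ x) y≢x)) (∧-identityʳ (S y))

  ∈-─⁺ : ∀ {y} → y ∈ S → y ≢ x → y ∈ S ─ x
  ∈-─⁺ y∈S y≢x = trans (─-≢ y≢x) y∈S

  ∣─∣ : x ∈ S → ∣ S ∣ ≡ suc ∣ S ─ x ∣
  ∣─∣ x∈S = begin
    ∣ S ∣
      ≡⟨ sum-split x (𝟙 ∘ S) ⟩
    𝟙 (S x) + sum (λ i → 𝟙 (not (does (i ≟ x))) * 𝟙 (S i))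
      ≡⟨ cong₂ _+_ (cong 𝟙 x∈S) (sum-cong-≗ λ i → trans (*-comm _ (𝟙 (S i))) (sym (𝟙-∧ (S i) _))) ⟩
    suc ∣ S ─ x ∣ ∎
    where open ≡-Reasoning

∣─∣≡ : ∀ (S : Subset n) x {k} → x ∈ S → ∣ S ∣ ≡ suc k → ∣ S ─ x ∣ ≡ k
∣─∣≡ S x x∈S ∣S∣ = suc-injective (trans (sym (∣─∣ S x x∈S)) ∣S∣)

∣──∣ : ∀ (S : Subset n) x y → x ∈ S → y ∈ S → y ≢ x → ∣ S ∣ ≡ suc (suc ∣ S ─ x ─ y ∣)
∣──∣ S x y x∈S y∈S y≢x = trans (∣─∣ S x x∈S) (cong suc (∣─∣ (S ─ x) y (∈-─⁺ S x y∈S y≢x)))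

⊆⇒∣∣≤ : ∀ {A S : Subset n} → (∀ x → x ∈ A → x ∈ S) → ∣ A ∣ ≤ ∣ S ∣
⊆⇒∣∣≤ A⊆S = sum-mono-≤ (λ x → 𝟙-mono (A⊆S x))

∣∣≡0⇒∉ : ∀ (S : Subset n) → ∣ S ∣ ≡ 0 → ∀ x → S x ≡ false
∣∣≡0⇒∉ S ∣S∣≡0 x with S x in Sx
... | false = refl
... | true = ⊥-elim (1+n≢0 (trans (cong 𝟙 (sym Sx)) (sum≡0⇒≡0 (𝟙 ∘ S) ∣S∣≡0 x)))

∣∣≡1⇒≡ : ∀ (S : Subset n) → ∣ S ∣ ≡ 1 → ∀ {x y} → x ∈ S → y ∈ S → y ≡ x
∣∣≡1⇒≡ S ∣S∣≡1 {x} {y} x∈S y∈S with y ≟ x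
... | yes y≡x = y≡x
... | no y≢x = ⊥-elim (true≢false (trans (sym (∈-─⁺ S x y∈S y≢x))
                 (∣∣≡0⇒∉ (S ─ x) (∣─∣≡ S x x∈S ∣S∣≡1) y)))

∣∣≡suc⇒nonempty : ∀ (S : Subset n) {m} → ∣ S ∣ ≡ suc m → ∃ λ w → w ∈ S
∣∣≡suc⇒nonempty {n} S ∣S∣≡suc with find S
... | inj₁ found = found
... | inj₂ none = ⊥-elim (1+n≢0 (trans (sym ∣S∣≡suc) (trans (sum-cong-≗ (cong 𝟙 ∘ none)) (sum-replicate-zero n))))

─-empty⇒≡ : ∀ (p : Subset n) x {y} → (∀ z → (p ─ x) z ≡ false) → y ∈ p → y ≡ x
─-empty⇒≡ p x {y} none y∈p with y ≟ x
... | yes y≡x = y≡x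
... | no y≢x = ⊥-elim (true≢false (trans (sym (∈-─⁺ p x y∈p y≢x)) (none y)))

sum-𝟙-split : ∀ (p : Subset n) x (f : Fin n → ℕ) →
  sum (λ y → 𝟙 (p y) * f y) ≡ 𝟙 (p x) * f x + sum (λ y → 𝟙 ((p ─ x) y) * f y)
sum-𝟙-split p x f = trans (sum-split x (λ y → 𝟙 (p y) * f y))
  (cong (𝟙 (p x) * f x +_) (sum-cong-≗ λ y → 𝟙*𝟙* _ (p y) (f y)))

sum-𝟙-only : ∀ (p : Subset n) x (f : Fin n → ℕ) → x ∈ p → (∀ y → y ∈ p → y ≡ x) →
  sum (λ y → 𝟙 (p y) * f y) ≡ f x
sum-𝟙-only p x f x∈p only = trans (sum-cong-≗ λ y → cong (λ b → 𝟙 b * f y) (p≡ y)) (sum-𝟙-≡ x f)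
  where
  p≡ : ∀ y → p y ≡ does (y ≟ x)
  p≡ y = bool-ext (dec-true (y ≟ x) ∘ only y) (λ y≡x → subst (_∈ p) (sym (does⇒ (y ≟ x) y≡x)) x∈p)

data Census (p : Subset n) : Set where
  no-element    : (∀ y → p y ≡ false) → Census p
  one-element   : ∀ y → y ∈ p → (∀ z → z ∈ p → z ≡ y) → Census p
  two-elements  : ∀ y₁ y₂ → y₁ ∈ p → y₂ ∈ p ─ y₁ → (∀ z → z ∈ p ─ y₁ → z ≡ y₂) → Census p
  three-or-more : ∀ y₁ y₂ y₃ → y₁ ∈ p → y₂ ∈ p ─ y₁ → y₃ ∈ p ─ y₁ ─ y₂ → Census p

census : (p : Subset n) → Census p
census p with find p
... | inj₂ empty = no-element empty
... | inj₁ (y₁ , y₁∈) with find (p ─ y₁)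
...   | inj₂ only-y₁ = one-element y₁ y₁∈ (λ z → ─-empty⇒≡ p y₁ only-y₁)
...   | inj₁ (y₂ , y₂∈) with find (p ─ y₁ ─ y₂)
...     | inj₂ only-y₂ = two-elements y₁ y₂ y₁∈ y₂∈ (λ z → ─-empty⇒≡ (p ─ y₁) y₂ only-y₂)
...     | inj₁ (y₃ , y₃∈) = three-or-more y₁ y₂ y₃ y₁∈ y₂∈ y₃∈

full : Subset n
full _ = true

∣full∣ : ∣ full {n} ∣ ≡ n
∣full∣ {zero} = refl
∣full∣ {suc n} = cong suc (∣full∣ {n})

-- Inverting a labelling

injective⇒surjective : (f : Fin n → Fin n) → (∀ x y → f x ≡ f y → x ≡ y) → ∀ i → ∃ λ x → f x ≡ i
injective⇒surjective {suc m} f inj i with any? (λ x → f x ≟ i)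
... | yes found = found
... | no missed = ⊥-elim (Fin.<-irrefl (inj a b (punchOut-injective (f≢i a) (f≢i b) same)) a<b)
  where
  f≢i : ∀ x → i ≢ f x
  f≢i x i≡fx = missed (x , sym i≡fx)
  collision = pigeonhole (n<1+n m) (λ x → punchOut (f≢i x))
  a = proj₁ collision
  b = proj₁ (proj₂ collision)
  a<b = proj₁ (proj₂ (proj₂ collision))
  same = proj₂ (proj₂ (proj₂ collision))

preimage : Vec (Fin n) n → Fin n → Fin n
preimage v i with any? (λ x → lookup v x ≟ i)
... | yes (x , _) = x
... | no _ = i

lookup-preimage : ∀ (v : Vec (Fin n) n) i → (∃ λ x → lookup v x ≡ i) → lookup v (preimage v i) ≡ i
lookup-preimage v i hit with any? (λ x → lookup v x ≟ i)
... | yes (x , vx≡i) = vx≡i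
... | no missed = ⊥-elim (missed hit)

inverse : Vec (Fin n) n → Vec (Fin n) n
inverse v = tabulate (preimage v)

record AreInverse (ℓ σ : Vec (Fin n) n) : Set where
  constructor mkInverse
  field
    σ∘ℓ : ∀ x → lookup σ (lookup ℓ x) ≡ x
    ℓ∘σ : ∀ i → lookup ℓ (lookup σ i) ≡ i

module _ {ℓ σ : Vec (Fin n) n} (inv : AreInverse ℓ σ) where
  open AreInverse inv

  AreInverse-sym : AreInverse σ ℓ
  AreInverse-sym = mkInverse ℓ∘σ σ∘ℓ

  AreInverse⇒injective : IsInjective ℓ
  AreInverse⇒injective x y ℓx≡ℓy = trans (sym (σ∘ℓ x)) (trans (cong (lookup σ) ℓx≡ℓy) (σ∘ℓ y))

  inverse-unique : inverse ℓ ≡ σ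
  inverse-unique = trans (tabulate-cong same) (tabulate∘lookup σ)
    where
    same : preimage ℓ ≗ lookup σ
    same i = AreInverse⇒injective _ _ (trans (lookup-preimage ℓ i (lookup σ i , ℓ∘σ i)) (sym (ℓ∘σ i)))

inverse-areInverse : ∀ (ℓ : Vec (Fin n) n) → IsInjective ℓ → AreInverse ℓ (inverse ℓ)
inverse-areInverse ℓ inj = mkInverse (λ x → inj _ _ (ℓσ (lookup ℓ x))) ℓσ
  where
  ℓσ : ∀ i → lookup ℓ (lookup (inverse ℓ) i) ≡ i
  ℓσ i = trans (cong (lookup ℓ) (lookup∘tabulate (preimage ℓ) i))
               (lookup-preimage ℓ i (injective⇒surjective (lookup ℓ) inj i))

-- Counting linear extensions recursively

module Extensions (lt : Fin n → Fin n → Bool) where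

  minimal? : Subset n → Fin n → Bool
  minimal? S x = S x ∧ allᵇ (λ y → not (S y ∧ lt y x))

  -- For k = ∣ S ∣ this counts the linear extensions of S, by the choice of a minimal first element;
  -- k is a separate argument only to make the recursion structural.
  linExt : ℕ → Subset n → ℕ
  linExt zero S = 1
  linExt (suc k) S = sum (λ x → 𝟙 (minimal? S x) * linExt k (S ─ x))

  Isolated : Subset n → Fin n → Set
  Isolated S w = w ∈ S × (∀ z → z ∈ S → lt z w ≡ false × lt w z ≡ false)

  NoIsolated : Subset n → Set
  NoIsolated S = ∀ w → w ∈ S → ∃ λ z → z ∈ S × (lt z w ≡ true ⊎ lt w z ≡ true)

  Antichain : Subset n → Set
  Antichain S = ∀ u v → u ∈ S → v ∈ S → lt u v ≡ false

  module _ (S : Subset n) (x : Fin n) where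

    minimal⇒∈ : minimal? S x ≡ true → x ∈ S
    minimal⇒∈ = ∧-conicalˡ (S x) _

    minimal⇒¬below : minimal? S x ≡ true → ∀ {y} → y ∈ S → lt y x ≡ false
    minimal⇒¬below min {y} y∈S =
      not-injective (subst (λ b → not (b ∧ lt y x) ≡ true) y∈S (allᵇ-elim (∧-conicalʳ (S x) _ min) y))

    minimal-intro : x ∈ S → (∀ y → y ∈ S → lt y x ≡ false) → minimal? S x ≡ true
    minimal-intro x∈S nothing-below = cong₂ _∧_ x∈S (allᵇ-intro no-y)
      where
      no-y : ∀ y → not (S y ∧ lt y x) ≡ true
      no-y y with S y in y∈S
      ... | true = cong not (nothing-below y y∈S)
      ... | false = refl

    ¬minimal⇒below : x ∈ S → minimal? S x ≡ false → ∃ λ y → y ∈ S × lt y x ≡ true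
    ¬minimal⇒below x∈S ¬min with allᵇ (λ y → not (S y ∧ lt y x)) in none-below
    ... | true = ⊥-elim (true≢false (trans (sym (cong (_∧ true) x∈S)) ¬min))
    ... | false with allᵇ-counterexample none-below
    ...   | y , below = y , ∧-conicalˡ (S y) _ y-below , ∧-conicalʳ (S y) _ y-below
      where
      y-below : S y ∧ lt y x ≡ true
      y-below = not-injective below

  isolated? : Subset n → Fin n → Bool
  isolated? S w = S w ∧ allᵇ (λ z → not (S z ∧ (lt z w ∨ lt w z)))

  isolated-or-not : ∀ S → (∃ λ w → Isolated S w) ⊎ NoIsolated S
  isolated-or-not S with find (isolated? S)
  ... | inj₁ (w , iso) = inj₁ (w , ∧-conicalˡ (S w) _ iso , incomparable)
    where
    incomparable : ∀ z → z ∈ S → lt z w ≡ false × lt w z ≡ false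
    incomparable z z∈S = ∨-conicalˡ (lt z w) _ neither , ∨-conicalʳ (lt z w) _ neither
      where
      neither : (lt z w ∨ lt w z) ≡ false
      neither = not-injective (subst (λ b → not (b ∧ (lt z w ∨ lt w z)) ≡ true) z∈S
        (allᵇ-elim (∧-conicalʳ (S w) _ iso) z))
  ... | inj₂ none = inj₂ λ w w∈S →
    let z , z~w = allᵇ-counterexample {p = λ z → not (S z ∧ (lt z w ∨ lt w z))}
                    (subst (λ b → b ∧ allᵇ (λ z → not (S z ∧ (lt z w ∨ lt w z))) ≡ false) w∈S (none w))
        z-comparable = not-injective {y = true} z~w
    in z , ∧-conicalˡ (S z) _ z-comparable ,
       ⊎-map T⇒≡true T⇒≡true (Equivalence.to T-∨ (≡true⇒T (∧-conicalʳ (S z) _ z-comparable)))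

  minimal-─ : ∀ S y z → minimal? S z ≡ true → z ≢ y → minimal? (S ─ y) z ≡ true
  minimal-─ S y z min z≢y = minimal-intro (S ─ y) z (∈-─⁺ S y (minimal⇒∈ S z min) z≢y)
    (λ u u∈ → minimal⇒¬below S z min (∈-─⁻ S y u∈))

  minimal-of-─ : ∀ S x y → minimal? (S ─ x) y ≡ true → lt x y ≡ false → minimal? S y ≡ true
  minimal-of-─ S x y min x≮y = minimal-intro S y (∈-─⁻ S x y∈) nothing-below
    where
    y∈ = minimal⇒∈ (S ─ x) y min
    nothing-below : ∀ u → u ∈ S → lt u y ≡ false
    nothing-below u u∈S with u ≟ x
    ... | yes refl = x≮y
    ... | no u≢x = minimal⇒¬below (S ─ x) y min (∈-─⁺ S x u∈S u≢x)

  minimal-cong : ∀ {S T} → S ≗ T → minimal? S ≗ minimal? T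
  minimal-cong S≗T x = cong₂ _∧_ (S≗T x) (allᵇ-cong (λ y → cong (λ b → not (b ∧ lt y x)) (S≗T y)))

  linExt-cong : ∀ k {S T} → S ≗ T → linExt k S ≡ linExt k T
  linExt-cong zero S≗T = refl
  linExt-cong (suc k) S≗T =
    sum-cong-≗ (λ x → cong₂ _*_ (cong 𝟙 (minimal-cong S≗T x)) (linExt-cong k (─-cong S≗T x)))

  others : ℕ → Subset n → Fin n → ℕ
  others k S x = sum (λ z → 𝟙 ((minimal? S ─ x) z) * linExt k (S ─ z))

  linExt-split : ∀ k S x → linExt (suc k) S ≡ 𝟙 (minimal? S x) * linExt k (S ─ x) + others k S x
  linExt-split k S x = sum-𝟙-split (minimal? S) x (λ z → linExt k (S ─ z))

  others-vanish : ∀ k S x → (∀ z → z ∈ minimal? S ─ x → ⊥) → others k S x ≡ 0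
  others-vanish k S x none = trans (sum-cong-≗ vanish) (sum-replicate-zero n)
    where
    vanish : ∀ z → 𝟙 ((minimal? S ─ x) z) * linExt k (S ─ z) ≡ 0
    vanish z with (minimal? S ─ x) z in z∈
    ... | true = ⊥-elim (none z z∈)
    ... | false = refl

  others-singleton : ∀ k S x → x ∈ S → ∣ S ∣ ≡ 1 → others k S x ≡ 0
  others-singleton k S x x∈S ∣S∣≡1 = others-vanish k S x λ z z∈ →
    ∈-─⇒≢ (minimal? S) x z∈ (∣∣≡1⇒≡ S ∣S∣≡1 x∈S (minimal⇒∈ S z (∈-─⁻ (minimal? S) x z∈)))

  others-mono : ∀ k S x d c k′ T →
    (∀ z → z ∈ minimal? S ─ x → minimal? T z ≡ true × d * linExt k (S ─ z) ≤ c * linExt k′ (T ─ z)) →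
    d * others k S x ≤ c * linExt (suc k′) T
  others-mono k S x d c k′ T h = begin
    d * others k S x
      ≡⟨ sym (sum-*ˡ d (λ z → 𝟙 ((minimal? S ─ x) z) * linExt k (S ─ z))) ⟩
    sum (λ z → d * (𝟙 ((minimal? S ─ x) z) * linExt k (S ─ z)))
      ≡⟨ sum-cong-≗ (λ z → x∙yz≈y∙xz d (𝟙 ((minimal? S ─ x) z)) _) ⟩
    sum (λ z → 𝟙 ((minimal? S ─ x) z) * (d * linExt k (S ─ z)))
      ≤⟨ sum-mono-≤ (λ z → 𝟙*-mono (h z)) ⟩
    sum (λ z → 𝟙 (minimal? T z) * (c * linExt k′ (T ─ z)))
      ≡⟨ sum-cong-≗ (λ z → x∙yz≈y∙xz (𝟙 (minimal? T z)) c _) ⟩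
    sum (λ z → c * (𝟙 (minimal? T z) * linExt k′ (T ─ z)))
      ≡⟨ sum-*ˡ c (λ z → 𝟙 (minimal? T z) * linExt k′ (T ─ z)) ⟩
    c * linExt (suc k′) T ∎
    where open ≤-Reasoning

  others-≡ : ∀ k S x c k′ T → (minimal? S ─ x ≗ minimal? T) →
    (∀ z → z ∈ minimal? S ─ x → linExt k (S ─ z) ≡ c * linExt k′ (T ─ z)) →
    others k S x ≡ c * linExt (suc k′) T
  others-≡ k S x c k′ T same h = begin
    others k S x
      ≡⟨ sum-cong-≗ (λ z → 𝟙*-cong (same z) (h z)) ⟩
    sum (λ z → 𝟙 (minimal? T z) * (c * linExt k′ (T ─ z)))
      ≡⟨ sum-cong-≗ (λ z → x∙yz≈y∙xz (𝟙 (minimal? T z)) c _) ⟩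
    sum (λ z → c * (𝟙 (minimal? T z) * linExt k′ (T ─ z)))
      ≡⟨ sum-*ˡ c (λ z → 𝟙 (minimal? T z) * linExt k′ (T ─ z)) ⟩
    c * linExt (suc k′) T ∎
    where open ≡-Reasoning

  linExt≤! : ∀ k S → ∣ S ∣ ≡ k → linExt k S ≤ k !
  linExt≤! zero S _ = ≤-refl
  linExt≤! (suc k) S ∣S∣ = begin
    linExt (suc k) S                ≤⟨ sum-mono-≤ (λ x → 𝟙*-mono (λ min → minimal⇒∈ S x min , bound x min)) ⟩
    sum (λ x → 𝟙 (S x) * k !)       ≡⟨ sum-cong-≗ (λ x → *-comm (𝟙 (S x)) (k !)) ⟩
    sum (λ x → k ! * 𝟙 (S x))       ≡⟨ sum-*ˡ (k !) (𝟙 ∘ S) ⟩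
    k ! * ∣ S ∣                     ≡⟨ cong (k ! *_) ∣S∣ ⟩
    k ! * suc k                     ≡⟨ *-comm (k !) (suc k) ⟩
    suc k !                         ∎
    where
    open ≤-Reasoning
    bound : ∀ x → minimal? S x ≡ true → linExt k (S ─ x) ≤ k !
    bound x min = linExt≤! k (S ─ x) (∣─∣≡ S x (minimal⇒∈ S x min) ∣S∣)

  linExt-remove-≤ : ∀ k S y → y ∈ S → ∣ S ∣ ≡ suc k → linExt (suc k) S ≤ suc k * linExt k (S ─ y)
  others-remove-≤ : ∀ k S y → y ∈ S → ∣ S ∣ ≡ suc k → others k S y ≤ k * linExt k (S ─ y)

  linExt-remove-≤ k S y y∈S ∣S∣ = begin
    linExt (suc k) S
      ≡⟨ linExt-split k S y ⟩
    𝟙 (minimal? S y) * linExt k (S ─ y) + others k S y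
      ≤⟨ +-mono-≤ (𝟙*-≤ (minimal? S y) _) (others-remove-≤ k S y y∈S ∣S∣) ⟩
    linExt k (S ─ y) + k * linExt k (S ─ y) ∎
    where open ≤-Reasoning

  others-remove-≤ zero S y y∈S ∣S∣ = ≤-reflexive (others-singleton 0 S y y∈S ∣S∣)
  others-remove-≤ (suc k) S y y∈S ∣S∣ =
    subst (_≤ suc k * linExt (suc k) (S ─ y)) (*-identityˡ _)
      (others-mono (suc k) S y 1 (suc k) k (S ─ y) pointwise)
    where
    open ≤-Reasoning
    pointwise : ∀ z → z ∈ minimal? S ─ y →
      minimal? (S ─ y) z ≡ true × 1 * linExt (suc k) (S ─ z) ≤ suc k * linExt k (S ─ y ─ z)
    pointwise z z∈ = minimal-─ S y z z-min z≢y , (begin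
      1 * linExt (suc k) (S ─ z)   ≡⟨ *-identityˡ _ ⟩
      linExt (suc k) (S ─ z)       ≤⟨ linExt-remove-≤ k (S ─ z) y (∈-─⁺ S z y∈S (z≢y ∘ sym)) (∣─∣≡ S z z∈S ∣S∣) ⟩
      suc k * linExt k (S ─ z ─ y) ≡⟨ cong (suc k *_) (linExt-cong k (─-comm S z y)) ⟩
      suc k * linExt k (S ─ y ─ z) ∎)
      where
      z-min = ∈-─⁻ (minimal? S) y z∈
      z≢y = ∈-─⇒≢ (minimal? S) y z∈
      z∈S = minimal⇒∈ S z z-min

  module _ {S : Subset n} {w : Fin n} (iso : Isolated S w) where

    isolated⇒minimal : minimal? S w ≡ true
    isolated⇒minimal = minimal-intro S w (proj₁ iso) (λ y y∈S → proj₁ (proj₂ iso y y∈S))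

    isolated-─ : ∀ z → w ≢ z → Isolated (S ─ z) w
    isolated-─ z w≢z = ∈-─⁺ S z (proj₁ iso) w≢z , λ u u∈ → proj₂ iso u (∈-─⁻ S z u∈)

    minimal-─-isolated : minimal? (S ─ w) ≗ minimal? S ─ w
    minimal-─-isolated z = bool-ext to from
      where
      to : minimal? (S ─ w) z ≡ true → z ∈ minimal? S ─ w
      to min = ∈-─⁺ (minimal? S) w (minimal-of-─ S w z min (proj₂ (proj₂ iso z (∈-─⁻ S w z∈)))) (∈-─⇒≢ S w z∈)
        where z∈ = minimal⇒∈ (S ─ w) z min
      from : z ∈ minimal? S ─ w → minimal? (S ─ w) z ≡ true
      from z∈ = minimal-─ S w z (∈-─⁻ (minimal? S) w z∈) (∈-─⇒≢ (minimal? S) w z∈)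

  linExt-isolated : ∀ k S w → Isolated S w → ∣ S ∣ ≡ suc k → linExt (suc k) S ≡ suc k * linExt k (S ─ w)
  others-isolated : ∀ k S w → Isolated S w → ∣ S ∣ ≡ suc k → others k S w ≡ k * linExt k (S ─ w)

  linExt-isolated k S w iso ∣S∣ = begin
    linExt (suc k) S                                    ≡⟨ linExt-split k S w ⟩
    𝟙 (minimal? S w) * linExt k (S ─ w) + others k S w  ≡⟨ cong₂ _+_ first (others-isolated k S w iso ∣S∣) ⟩
    linExt k (S ─ w) + k * linExt k (S ─ w)             ∎
    where
    open ≡-Reasoning
    first : 𝟙 (minimal? S w) * linExt k (S ─ w) ≡ linExt k (S ─ w)
    first = trans (cong (λ b → 𝟙 b * linExt k (S ─ w)) (isolated⇒minimal iso)) (*-identityˡ _)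

  others-isolated zero S w iso ∣S∣ = others-singleton 0 S w (proj₁ iso) ∣S∣
  others-isolated (suc k) S w iso ∣S∣ =
    others-≡ (suc k) S w (suc k) k (S ─ w) (sym ∘ minimal-─-isolated iso) λ z z∈ →
      let z∈S = minimal⇒∈ S z (∈-─⁻ (minimal? S) w z∈)
          w≢z = ∈-─⇒≢ (minimal? S) w z∈ ∘ sym
      in begin
        linExt (suc k) (S ─ z)       ≡⟨ linExt-isolated k (S ─ z) w (isolated-─ iso z w≢z) (∣─∣≡ S z z∈S ∣S∣) ⟩
        suc k * linExt k (S ─ z ─ w) ≡⟨ cong (suc k *_) (linExt-cong k (─-comm S z w)) ⟩
        suc k * linExt k (S ─ w ─ z) ∎
    where open ≡-Reasoning

  antichain-linExt : ∀ b S → ∣ S ∣ ≡ b → Antichain S → b ! ≤ linExt b S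
  antichain-linExt zero S _ _ = ≤-refl
  antichain-linExt (suc b) S ∣S∣ anti = begin
    suc b !                    ≡⟨ *-comm (suc b) (b !) ⟩
    b ! * suc b                ≡⟨ cong (b ! *_) (sym ∣S∣) ⟩
    b ! * ∣ S ∣                ≡⟨ sym (sum-*ˡ (b !) (𝟙 ∘ S)) ⟩
    sum (λ z → b ! * 𝟙 (S z))  ≡⟨ sum-cong-≗ (λ z → *-comm (b !) (𝟙 (S z))) ⟩
    sum (λ z → 𝟙 (S z) * b !)  ≤⟨ sum-mono-≤ (λ z → 𝟙*-mono (pointwise z)) ⟩
    linExt (suc b) S           ∎
    where
    open ≤-Reasoning
    pointwise : ∀ z → z ∈ S → minimal? S z ≡ true × b ! ≤ linExt b (S ─ z)
    pointwise z z∈S = minimal-intro S z z∈S (λ u u∈S → anti u z u∈S z∈S) ,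
      antichain-linExt b (S ─ z) (∣─∣≡ S z z∈S ∣S∣) (λ u v u∈ v∈ → anti u v (∈-─⁻ S z u∈) (∈-─⁻ S z v∈))

  -- Any ordering of A followed by any ordering of the rest of S is a linear extension.
  linExt-layers : ∀ a b S A → ∣ S ∣ ≡ a + b → ∣ A ∣ ≡ a → (∀ z → z ∈ A → minimal? S z ≡ true) →
    (∀ u v → u ∈ S → A u ≡ false → v ∈ S → A v ≡ false → lt u v ≡ false) →
    a ! * b ! ≤ linExt (a + b) S
  linExt-layers zero b S A ∣S∣ ∣A∣ _ anti = begin
    1 * b !       ≡⟨ *-identityˡ (b !) ⟩
    b !           ≤⟨ antichain-linExt b S ∣S∣ (λ u v u∈S v∈S → anti u v u∈S (∅ u) v∈S (∅ v)) ⟩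
    linExt b S    ∎
    where
    open ≤-Reasoning
    ∅ = ∣∣≡0⇒∉ A ∣A∣
  linExt-layers (suc a) b S A ∣S∣ ∣A∣ A-min anti = begin
    (suc a * a !) * b !                  ≡⟨ *-assoc (suc a) (a !) (b !) ⟩
    suc a * (a ! * b !)                  ≡⟨ *-comm (suc a) _ ⟩
    (a ! * b !) * suc a                  ≡⟨ cong ((a ! * b !) *_) (sym ∣A∣) ⟩
    (a ! * b !) * ∣ A ∣                  ≡⟨ sym (sum-*ˡ (a ! * b !) (𝟙 ∘ A)) ⟩
    sum (λ z → (a ! * b !) * 𝟙 (A z))    ≡⟨ sum-cong-≗ (λ z → *-comm (a ! * b !) (𝟙 (A z))) ⟩
    sum (λ z → 𝟙 (A z) * (a ! * b !))    ≤⟨ sum-mono-≤ (λ z → 𝟙*-mono (pointwise z)) ⟩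
    linExt (suc a + b) S                 ∎
    where
    open ≤-Reasoning
    pointwise : ∀ z → z ∈ A → minimal? S z ≡ true × a ! * b ! ≤ linExt (a + b) (S ─ z)
    pointwise z z∈A = A-min z z∈A , linExt-layers a b (S ─ z) (A ─ z)
      (∣─∣≡ S z (minimal⇒∈ S z (A-min z z∈A)) ∣S∣) (∣─∣≡ A z z∈A ∣A∣)
      (λ u u∈ → minimal-─ S z u (A-min u (∈-─⁻ A z u∈)) (∈-─⇒≢ A z u∈))
      (λ u v u∈ u∉ v∈ v∉ → anti u v (∈-─⁻ S z u∈) (outside u u∈ u∉) (∈-─⁻ S z v∈) (outside v v∈ v∉))
      where
      outside : ∀ u → u ∈ S ─ z → (A ─ z) u ≡ false → A u ≡ false
      outside u u∈ u∉ = trans (sym (─-≢ A z (∈-─⇒≢ S z u∈))) u∉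

  valid? : ∀ {k} → Subset n → Vec (Fin n) k → Bool
  valid? S [] = true
  valid? S (x ∷ σ) = minimal? S x ∧ valid? (S ─ x) σ

  count-valid : ∀ k S → ∑ᴸ (allVecs n k) (𝟙 ∘ valid? S) ≡ linExt k S
  count-valid zero S = refl
  count-valid (suc k) S = begin
    ∑ᴸ (allVecs n (suc k)) (𝟙 ∘ valid? S)
      ≡⟨ ∑-allVecs-suc k (𝟙 ∘ valid? S) ⟩
    sum (λ x → ∑ᴸ (allVecs n k) (λ σ → 𝟙 (minimal? S x ∧ valid? (S ─ x) σ)))
      ≡⟨ sum-cong-≗ (λ x → trans (∑ᴸ-cong (allVecs n k) (λ σ → 𝟙-∧ (minimal? S x) _))
                                 (∑ᴸ-*ˡ (allVecs n k) (𝟙 (minimal? S x)) (𝟙 ∘ valid? (S ─ x)))) ⟩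
    sum (λ x → 𝟙 (minimal? S x) * ∑ᴸ (allVecs n k) (𝟙 ∘ valid? (S ─ x)))
      ≡⟨ sum-cong-≗ (λ x → cong (𝟙 (minimal? S x) *_) (count-valid k (S ─ x))) ⟩
    linExt (suc k) S ∎
    where open ≡-Reasoning

  Distinct : ∀ {k} → Vec (Fin n) k → Set
  Distinct σ = ∀ i j → lookup σ i ≡ lookup σ j → i ≡ j

  Respects : ∀ {k} → Vec (Fin n) k → Set
  Respects σ = ∀ i j → lt (lookup σ i) (lookup σ j) ≡ true → toℕ i < toℕ j

  valid⇒ : ∀ {k} S (σ : Vec (Fin n) k) → valid? S σ ≡ true →
    (∀ i → lookup σ i ∈ S) × Distinct σ × Respects σ
  valid⇒ S [] _ = (λ ()) , (λ ()) , (λ ())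
  valid⇒ S (a ∷ σ) v with valid⇒ (S ─ a) σ (∧-conicalʳ (minimal? S a) _ v)
  ... | ∈S─a , distinct , respects = ∈S , distinct′ , respects′
    where
    a-min = ∧-conicalˡ (minimal? S a) _ v
    ∈S : ∀ i → lookup (a ∷ σ) i ∈ S
    ∈S zero = minimal⇒∈ S a a-min
    ∈S (suc i) = ∈-─⁻ S a (∈S─a i)
    distinct′ : Distinct (a ∷ σ)
    distinct′ zero zero _ = refl
    distinct′ zero (suc j) a≡σj = ⊥-elim (∈-─⇒≢ S a (∈S─a j) (sym a≡σj))
    distinct′ (suc i) zero σi≡a = ⊥-elim (∈-─⇒≢ S a (∈S─a i) σi≡a)
    distinct′ (suc i) (suc j) σi≡σj = cong suc (distinct i j σi≡σj)
    respects′ : Respects (a ∷ σ)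
    respects′ zero zero a<a =
      ⊥-elim (true≢false (trans (sym a<a) (minimal⇒¬below S a a-min (minimal⇒∈ S a a-min))))
    respects′ zero (suc j) _ = s≤s z≤n
    respects′ (suc i) zero σi<a =
      ⊥-elim (true≢false (trans (sym σi<a) (minimal⇒¬below S a a-min (∈-─⁻ S a (∈S─a i)))))
    respects′ (suc i) (suc j) σi<σj = s≤s (respects i j σi<σj)

  valid⇐ : ∀ {k} S (σ : Vec (Fin n) k) → (∀ i → lookup σ i ∈ S) → Distinct σ → Respects σ →
    (∀ x → x ∈ S → ∃ λ i → lookup σ i ≡ x) → valid? S σ ≡ true
  valid⇐ S [] _ _ _ _ = refl
  valid⇐ S (a ∷ σ) ∈S distinct respects covers =
    cong₂ _∧_ a-min (valid⇐ (S ─ a) σ ∈S─a distinct′ respects′ covers′)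
    where
    a-min : minimal? S a ≡ true
    a-min = minimal-intro S a (∈S zero) nothing-below
      where
      nothing-below : ∀ y → y ∈ S → lt y a ≡ false
      nothing-below y y∈S with lt y a in y<a | covers y y∈S
      ... | false | _ = refl
      ... | true | i , refl = ⊥-elim (n≮0 (respects i zero y<a))
    ∈S─a : ∀ i → lookup σ i ∈ S ─ a
    ∈S─a i = ∈-─⁺ S a (∈S (suc i)) (λ σi≡a → 0≢1+n (cong toℕ (distinct zero (suc i) (sym σi≡a))))
    distinct′ : Distinct σ
    distinct′ i j σi≡σj = Fin.suc-injective (distinct (suc i) (suc j) σi≡σj)
    respects′ : Respects σ
    respects′ i j σi<σj = ≤-pred (respects (suc i) (suc j) σi<σj)
    covers′ : ∀ x → x ∈ S ─ a → ∃ λ i → lookup σ i ≡ x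
    covers′ x x∈ with covers x (∈-─⁻ S a x∈)
    ... | zero , a≡x = ⊥-elim (∈-─⇒≢ S a x∈ (sym a≡x))
    ... | suc i , σi≡x = i , σi≡x

  isLinearExtension⇒ : ∀ ℓ → isLinearExtension lt ℓ ≡ true → IsInjective ℓ × IsOrderPreserving lt ℓ
  isLinearExtension⇒ ℓ e =
    toWitness {a? = injective? ℓ} (≡true⇒T (∧-conicalˡ _ _ e)) ,
    toWitness {a? = orderPreserving? lt ℓ} (≡true⇒T (∧-conicalʳ (⌊ injective? ℓ ⌋) _ e))

  isLinearExtension⇐ : ∀ ℓ → IsInjective ℓ → IsOrderPreserving lt ℓ → isLinearExtension lt ℓ ≡ true
  isLinearExtension⇐ ℓ inj ord = cong₂ _∧_ (T⇒≡true (fromWitness {a? = injective? ℓ} inj))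
                                           (T⇒≡true (fromWitness {a? = orderPreserving? lt ℓ} ord))

  module _ {ℓ σ : Vec (Fin n) n} (inv : AreInverse ℓ σ) where
    open AreInverse inv

    orderPreserving⇒valid : IsOrderPreserving lt ℓ → valid? full σ ≡ true
    orderPreserving⇒valid ord = valid⇐ full σ (λ _ → refl)
      (AreInverse⇒injective (AreInverse-sym inv)) respects (λ x _ → lookup ℓ x , σ∘ℓ x)
      where
      respects : Respects σ
      respects i j σi<σj = subst₂ (λ a b → toℕ a < toℕ b) (ℓ∘σ i) (ℓ∘σ j) (ord _ _ (≡true⇒T σi<σj))

    valid⇒orderPreserving : valid? full σ ≡ true → IsOrderPreserving lt ℓ
    valid⇒orderPreserving v x y x<y = proj₂ (proj₂ (valid⇒ full σ v)) (lookup ℓ x) (lookup ℓ y)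
      (subst₂ (λ a b → lt a b ≡ true) (sym (σ∘ℓ x)) (sym (σ∘ℓ y)) (T⇒≡true x<y))

  -- A linear extension ℓ labels each element by its position; the corresponding valid
  -- sequence σ = inverse ℓ lists the elements in order.
  linearExtension-graph : ∀ ℓ σ →
    (isLinearExtension lt ℓ ∧ does (σ ≟ᵛ inverse ℓ)) ≡ (valid? full σ ∧ does (ℓ ≟ᵛ inverse σ))
  linearExtension-graph ℓ σ = bool-ext to from
    where
    to : (isLinearExtension lt ℓ ∧ does (σ ≟ᵛ inverse ℓ)) ≡ true → (valid? full σ ∧ does (ℓ ≟ᵛ inverse σ)) ≡ true
    to h = cong₂ _∧_ (orderPreserving⇒valid inv ord)
                     (dec-true (ℓ ≟ᵛ inverse σ) (sym (inverse-unique (AreInverse-sym inv))))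
      where
      ℓ-ext = isLinearExtension⇒ ℓ (∧-conicalˡ _ _ h)
      ord = proj₂ ℓ-ext
      σ≡ = does⇒ (σ ≟ᵛ inverse ℓ) (∧-conicalʳ _ _ h)
      inv : AreInverse ℓ σ
      inv = subst (AreInverse ℓ) (sym σ≡) (inverse-areInverse ℓ (proj₁ ℓ-ext))
    from : (valid? full σ ∧ does (ℓ ≟ᵛ inverse σ)) ≡ true → (isLinearExtension lt ℓ ∧ does (σ ≟ᵛ inverse ℓ)) ≡ true
    from h = cong₂ _∧_ (isLinearExtension⇐ ℓ (AreInverse⇒injective inv) (valid⇒orderPreserving inv v))
                       (dec-true (σ ≟ᵛ inverse ℓ) (sym (inverse-unique inv)))
      where
      v = ∧-conicalˡ _ _ h
      ℓ≡ = does⇒ (ℓ ≟ᵛ inverse σ) (∧-conicalʳ _ _ h)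
      inv : AreInverse ℓ σ
      inv = subst (λ t → AreInverse t σ) (sym ℓ≡)
        (AreInverse-sym (inverse-areInverse σ (proj₁ (proj₂ (valid⇒ full σ v)))))

  numLinExt≡linExt : numLinExt n lt ≡ linExt n full
  numLinExt≡linExt = begin
    numLinExt n lt                              ≡⟨ length-filter (isLinearExtension lt) (allVecs n n) ⟩
    ∑ᴸ (allVecs n n) (𝟙 ∘ isLinearExtension lt) ≡⟨ count-bijection (isLinearExtension lt) (valid? full)
                                                      inverse inverse linearExtension-graph ⟩
    ∑ᴸ (allVecs n n) (𝟙 ∘ valid? full)           ≡⟨ count-valid n full ⟩
    linExt n full                                ∎
    where
    open ≡-Reasoning
    open DoubleCounting _≟ᵛ_ (allVecs n n) (allVecs-unique n)

  module Strict (irrefl : ∀ x → lt x x ≡ false) where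

    lt⇒≢ : ∀ {x y} → lt x y ≡ true → x ≢ y
    lt⇒≢ {x} x<y refl = true≢false (trans (sym x<y) (irrefl x))

    minimal⇒¬above : ∀ S x y z → x ∈ S → lt x y ≡ true → minimal? S z ≡ true → z ≢ y
    minimal⇒¬above S x y z x∈S x<y z-min refl = true≢false (trans (sym x<y) (minimal⇒¬below S z z-min x∈S))

    linExt-pair : ∀ k S x y → x ∈ S → y ∈ S → lt x y ≡ true → ∣ S ∣ ≡ suc (suc k) →
      2 * linExt (suc (suc k)) S ≤ suc (suc k) * (suc k * linExt k (S ─ x ─ y))
    others-pair : ∀ k S x y → x ∈ S → y ∈ S → lt x y ≡ true → ∣ S ∣ ≡ suc (suc k) →
      2 * others (suc k) S x ≤ suc k * (k * linExt k (S ─ x ─ y))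

    linExt-pair k S x y x∈S y∈S x<y ∣S∣ = begin
      2 * linExt (suc (suc k)) S
        ≡⟨ cong (2 *_) (linExt-split (suc k) S x) ⟩
      2 * (𝟙 (minimal? S x) * linExt (suc k) (S ─ x) + others (suc k) S x)
        ≡⟨ *-distribˡ-+ 2 (𝟙 (minimal? S x) * linExt (suc k) (S ─ x)) _ ⟩
      2 * (𝟙 (minimal? S x) * linExt (suc k) (S ─ x)) + 2 * others (suc k) S x
        ≤⟨ +-mono-≤ (*-monoʳ-≤ 2 first) (others-pair k S x y x∈S y∈S x<y ∣S∣) ⟩
      2 * (suc k * L) + suc k * (k * L)
        ≡⟨ arithmetic k L ⟩
      suc (suc k) * (suc k * L) ∎
      where
      open ≤-Reasoning
      L = linExt k (S ─ x ─ y)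
      first : 𝟙 (minimal? S x) * linExt (suc k) (S ─ x) ≤ suc k * L
      first = ≤-trans (𝟙*-≤ (minimal? S x) _)
        (linExt-remove-≤ k (S ─ x) y (∈-─⁺ S x y∈S (lt⇒≢ x<y ∘ sym)) (∣─∣≡ S x x∈S ∣S∣))
      arithmetic : ∀ k X → 2 * (suc k * X) + suc k * (k * X) ≡ suc (suc k) * (suc k * X)
      arithmetic = solve-∀

    others-pair zero S x y x∈S y∈S x<y ∣S∣ =
      ≤-trans (≤-reflexive (cong (2 *_) (others-vanish 1 S x no-other-minimal))) z≤n
      where
      no-other-minimal : ∀ z → z ∈ minimal? S ─ x → ⊥
      no-other-minimal z z∈ = minimal⇒¬above S x y z x∈S x<y z-min
        (∣∣≡1⇒≡ (S ─ x) (∣─∣≡ S x x∈S ∣S∣) (∈-─⁺ S x y∈S (lt⇒≢ x<y ∘ sym))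
          (∈-─⁺ S x (minimal⇒∈ S z z-min) (∈-─⇒≢ (minimal? S) x z∈)))
        where z-min = ∈-─⁻ (minimal? S) x z∈
    others-pair (suc k) S x y x∈S y∈S x<y ∣S∣ = begin
      2 * others (suc (suc k)) S x              ≤⟨ others-mono (suc (suc k)) S x 2 c k R pointwise ⟩
      c * linExt (suc k) R                      ≡⟨ *-assoc (suc (suc k)) (suc k) _ ⟩
      suc (suc k) * (suc k * linExt (suc k) R) ∎
      where
      open ≤-Reasoning
      R = S ─ x ─ y
      c = suc (suc k) * suc k
      pointwise : ∀ z → z ∈ minimal? S ─ x →
        minimal? R z ≡ true × 2 * linExt (suc (suc k)) (S ─ z) ≤ c * linExt k (R ─ z)
      pointwise z z∈ = minimal-─ (S ─ x) y z (minimal-─ S x z z-min z≢x) z≢y , (begin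
        2 * linExt (suc (suc k)) (S ─ z)
          ≤⟨ linExt-pair k (S ─ z) x y (∈-─⁺ S z x∈S (z≢x ∘ sym)) (∈-─⁺ S z y∈S (z≢y ∘ sym)) x<y
                         (∣─∣≡ S z z∈S ∣S∣) ⟩
        suc (suc k) * (suc k * linExt k (S ─ z ─ x ─ y))
          ≡⟨ sym (*-assoc (suc (suc k)) (suc k) _) ⟩
        c * linExt k (S ─ z ─ x ─ y)
          ≡⟨ cong (c *_) (linExt-cong k (λ u → trans (─-cong (─-comm S z x) y u) (─-comm (S ─ x) z y u))) ⟩
        c * linExt k (R ─ z) ∎)
        where
        z-min = ∈-─⁻ (minimal? S) x z∈
        z∈S = minimal⇒∈ S z z-min
        z≢x = ∈-─⇒≢ (minimal? S) x z∈
        z≢y = minimal⇒¬above S x y z x∈S x<y z-min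

    data Matching (S : Subset n) : ℕ → Set where
      done : Matching S 0
      pair : ∀ {j} x y → x ∈ S → y ∈ S → lt x y ≡ true → Matching (S ─ x ─ y) j → Matching S (suc j)

    matching-bound : ∀ {S j k} → Matching S j → ∣ S ∣ ≡ k → 2 ^ j * linExt k S ≤ k !
    matching-bound {S} done refl = ≤-trans (≤-reflexive (*-identityˡ _)) (linExt≤! ∣ S ∣ S refl)
    matching-bound {S} {suc j} (pair x y x∈S y∈S x<y M) refl =
      subst (λ m → 2 ^ suc j * linExt m S ≤ m !) (sym ∣S∣) (begin
        (2 * 2 ^ j) * linExt (suc (suc t)) S
          ≡⟨ swap-2 (2 ^ j) _ ⟩
        2 ^ j * (2 * linExt (suc (suc t)) S)
          ≤⟨ *-monoʳ-≤ (2 ^ j) (linExt-pair t S x y x∈S y∈S x<y ∣S∣) ⟩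
        2 ^ j * (suc (suc t) * (suc t * L))
          ≡⟨ rotate (2 ^ j) (suc (suc t)) (suc t) L ⟩
        suc (suc t) * (suc t * (2 ^ j * L))
          ≤⟨ *-monoʳ-≤ (suc (suc t)) (*-monoʳ-≤ (suc t) (matching-bound M refl)) ⟩
        suc (suc t) * (suc t * t !) ∎)
      where
      open ≤-Reasoning
      t = ∣ S ─ x ─ y ∣
      L = linExt t (S ─ x ─ y)
      ∣S∣ = ∣──∣ S x y x∈S y∈S (lt⇒≢ x<y ∘ sym)
      swap-2 : ∀ p X → (2 * p) * X ≡ p * (2 * X)
      swap-2 = solve-∀
      rotate : ∀ p a b X → p * (a * (b * X)) ≡ a * (b * (p * X))
      rotate = solve-∀

    module HeightTwo (height2 : ∀ {x y z} → lt x y ≡ true → lt y z ≡ true → ⊥) where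

      onlyBelow? : Subset n → Fin n → Fin n → Bool
      onlyBelow? S x y = S x ∧ (lt x y ∧ minimal? (S ─ x) y)

      bothMinimal? : Subset n → Fin n → Fin n → Bool
      bothMinimal? S x y = minimal? S x ∧ (minimal? S ─ x) y

      module _ (S : Subset n) (x y : Fin n) (only : onlyBelow? S x y ≡ true) where

        onlyBelow⇒∈ : x ∈ S
        onlyBelow⇒∈ = ∧-conicalˡ (S x) _ only

        onlyBelow⇒lt : lt x y ≡ true
        onlyBelow⇒lt = ∧-conicalˡ (lt x y) _ (∧-conicalʳ (S x) _ only)

        onlyBelow⇒minimal-─ : minimal? (S ─ x) y ≡ true
        onlyBelow⇒minimal-─ = ∧-conicalʳ (lt x y) _ (∧-conicalʳ (S x) _ only)

        onlyBelow⇒∈─ : y ∈ S ─ x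
        onlyBelow⇒∈─ = minimal⇒∈ (S ─ x) y onlyBelow⇒minimal-─

        onlyBelow⇒∣──∣ : ∀ {k} → ∣ S ∣ ≡ suc (suc k) → ∣ S ─ x ─ y ∣ ≡ k
        onlyBelow⇒∣──∣ ∣S∣ = ∣─∣≡ (S ─ x) y onlyBelow⇒∈─ (∣─∣≡ S x onlyBelow⇒∈ ∣S∣)

        onlyBelow⇒unique : ∀ {z} → z ∈ S → lt z y ≡ true → z ≡ x
        onlyBelow⇒unique {z} z∈S z<y with z ≟ x
        ... | yes z≡x = z≡x
        ... | no z≢x = ⊥-elim (true≢false (trans (sym z<y)
                         (minimal⇒¬below (S ─ x) y onlyBelow⇒minimal-─ (∈-─⁺ S x z∈S z≢x))))

        onlyBelow⇒minimal : minimal? S x ≡ true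
        onlyBelow⇒minimal = minimal-intro S x onlyBelow⇒∈ (λ z _ → nothing-below z)
          where
          nothing-below : ∀ z → lt z x ≡ false
          nothing-below z with lt z x in z<x
          ... | true = ⊥-elim (height2 z<x onlyBelow⇒lt)
          ... | false = refl

      bothMinimal-sym : ∀ S x y → bothMinimal? S x y ≡ bothMinimal? S y x
      bothMinimal-sym S x y = bool-ext (swap x y) (swap y x)
        where
        swap : ∀ x y → bothMinimal? S x y ≡ true → bothMinimal? S y x ≡ true
        swap x y both =
          cong₂ _∧_ (∈-─⁻ (minimal? S) x y∈) (∈-─⁺ (minimal? S) y x-min (∈-─⇒≢ (minimal? S) x y∈ ∘ sym))
          where
          x-min = ∧-conicalˡ (minimal? S x) _ both
          y∈ = ∧-conicalʳ (minimal? S x) _ both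

      bothMinimal-diag : ∀ S x → bothMinimal? S x x ≡ false
      bothMinimal-diag S x = trans (cong (minimal? S x ∧_) x∉) (∧-zeroʳ (minimal? S x))
        where x∉ = ¬-not (λ x∈ → ∈-─⇒≢ (minimal? S) x x∈ refl)

      first-two-steps : ∀ S x y →
        𝟙 (minimal? S x) * 𝟙 (minimal? (S ─ x) y) ≡ 𝟙 (bothMinimal? S x y) + 𝟙 (onlyBelow? S x y)
      first-two-steps S x y with minimal? S x in x-min
      ... | false with onlyBelow? S x y in only
      ...   | false = refl
      ...   | true = ⊥-elim (true≢false (trans (sym (onlyBelow⇒minimal S x y only)) x-min))
      first-two-steps S x y | true = begin
        𝟙 true * 𝟙 (minimal? (S ─ x) y)
          ≡⟨ *-identityˡ _ ⟩
        𝟙 (minimal? (S ─ x) y)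
          ≡⟨ 𝟙-by-cases (minimal? (S ─ x) y) ((minimal? S ─ x) y) (lt x y) not-minimal-in-S minimal-in-S ⟩
        𝟙 ((minimal? S ─ x) y) + 𝟙 (lt x y ∧ minimal? (S ─ x) y)
          ≡⟨ cong (λ b → 𝟙 ((minimal? S ─ x) y) + 𝟙 (b ∧ (lt x y ∧ minimal? (S ─ x) y))) (sym x∈S) ⟩
        𝟙 ((minimal? S ─ x) y) + 𝟙 (S x ∧ (lt x y ∧ minimal? (S ─ x) y)) ∎
        where
        open ≡-Reasoning
        x∈S = minimal⇒∈ S x x-min
        not-minimal-in-S : lt x y ≡ true → (minimal? S ─ x) y ≡ false
        not-minimal-in-S x<y = ¬-not λ y∈ → true≢false
          (trans (sym x<y) (minimal⇒¬below S y (∈-─⁻ (minimal? S) x y∈) x∈S))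
        minimal-in-S : lt x y ≡ false → (minimal? S ─ x) y ≡ minimal? (S ─ x) y
        minimal-in-S x≮y = bool-ext
          (λ y∈ → minimal-─ S x y (∈-─⁻ (minimal? S) x y∈) (∈-─⇒≢ (minimal? S) x y∈))
          (λ min → ∈-─⁺ (minimal? S) x (minimal-of-─ S x y min x≮y) (∈-─⇒≢ S x (minimal⇒∈ (S ─ x) y min)))

      linExt-parity : ∀ k S → parity (linExt (suc (suc k)) S) ≡
        parity (sum (λ x → sum (λ y → 𝟙 (onlyBelow? S x y) * linExt k (S ─ x ─ y))))
      linExt-parity k S = begin
        parity (linExt (suc (suc k)) S)
          ≡⟨ cong parity (sum-cong-≗ expand) ⟩
        parity (sum (λ x → sum (λ y → g x y + h x y)))
          ≡⟨ cong parity (trans (sum-cong-≗ (λ x → ∑-distrib-+ (g x) (h x))) (∑-distrib-+ (λ x → sum (g x)) _)) ⟩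
        parity (sum (λ x → sum (g x)) + sum (λ x → sum (h x)))
          ≡⟨ +-homo-+ (sum (λ x → sum (g x))) _ ⟩
        parity (sum (λ x → sum (g x))) ℙ.+ parity (sum (λ x → sum (h x)))
          ≡⟨ cong (ℙ._+ parity (sum (λ x → sum (h x)))) (parity-symmetric-sum g g-sym g-diag) ⟩
        parity (sum (λ x → sum (h x))) ∎
        where
        open ≡-Reasoning
        L : Fin n → Fin n → ℕ
        L x y = linExt k (S ─ x ─ y)
        g h : Fin n → Fin n → ℕ
        g x y = 𝟙 (bothMinimal? S x y) * L x y
        h x y = 𝟙 (onlyBelow? S x y) * L x y
        expand : ∀ x → 𝟙 (minimal? S x) * linExt (suc k) (S ─ x) ≡ sum (λ y → g x y + h x y)
        expand x = trans (*-distribˡ-sum (𝟙 (minimal? S x)) (λ y → 𝟙 (minimal? (S ─ x) y) * L x y))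
          (sum-cong-≗ λ y → begin
            𝟙 (minimal? S x) * (𝟙 (minimal? (S ─ x) y) * L x y)
              ≡⟨ *-assoc (𝟙 (minimal? S x)) _ _ ⟨
            (𝟙 (minimal? S x) * 𝟙 (minimal? (S ─ x) y)) * L x y
              ≡⟨ cong (_* L x y) (first-two-steps S x y) ⟩
            (𝟙 (bothMinimal? S x y) + 𝟙 (onlyBelow? S x y)) * L x y
              ≡⟨ *-distribʳ-+ (L x y) (𝟙 (bothMinimal? S x y)) _ ⟩
            g x y + h x y ∎)
        g-sym : ∀ x y → g x y ≡ g y x
        g-sym x y = cong₂ _*_ (cong 𝟙 (bothMinimal-sym S x y)) (linExt-cong k (─-comm S x y))
        g-diag : ∀ x → g x x ≡ 0
        g-diag x = cong (λ b → 𝟙 b * L x x) (bothMinimal-diag S x)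

      odd⇒matching : ∀ k S → ∣ S ∣ ≡ k → parity (linExt k S) ≡ 1ℙ → Matching S ⌊ k /2⌋
      odd⇒matching zero S _ _ = done
      odd⇒matching (suc zero) S _ _ = done
      odd⇒matching (suc (suc k)) S ∣S∣ odd
        with x , odd-row ← parity-sum-odd _ (trans (sym (linExt-parity k S)) odd)
        with y , odd-term ← parity-sum-odd _ odd-row
        with only , odd-rest ← parity-𝟙*-odd (onlyBelow? S x y) _ odd-term
        = pair x y (onlyBelow⇒∈ S x y only) (∈-─⁻ S x (onlyBelow⇒∈─ S x y only)) (onlyBelow⇒lt S x y only)
            (odd⇒matching k (S ─ x ─ y) (onlyBelow⇒∣──∣ S x y only ∣S∣) odd-rest)

      two-isolated-even : ∀ k T w₁ w₂ → Isolated T w₁ → Isolated T w₂ → w₂ ≢ w₁ → ∣ T ∣ ≡ k →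
        parity (linExt k T) ≡ 0ℙ
      two-isolated-even zero T w₁ _ iso₁ _ _ ∣T∣ =
        ⊥-elim (true≢false (trans (sym (proj₁ iso₁)) (∣∣≡0⇒∉ T ∣T∣ w₁)))
      two-isolated-even (suc zero) T w₁ w₂ iso₁ iso₂ w₂≢w₁ ∣T∣ =
        ⊥-elim (w₂≢w₁ (∣∣≡1⇒≡ T ∣T∣ (proj₁ iso₁) (proj₁ iso₂)))
      two-isolated-even (suc (suc k)) T w₁ w₂ iso₁ iso₂ w₂≢w₁ ∣T∣ = begin
        parity (linExt (suc (suc k)) T)
          ≡⟨ cong parity (linExt-isolated (suc k) T w₁ iso₁ ∣T∣) ⟩
        parity (suc (suc k) * linExt (suc k) (T ─ w₁))
          ≡⟨ cong (λ m → parity (suc (suc k) * m))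
               (linExt-isolated k (T ─ w₁) w₂ (isolated-─ iso₂ w₁ w₂≢w₁) (∣─∣≡ T w₁ (proj₁ iso₁) ∣T∣)) ⟩
        parity (suc (suc k) * (suc k * linExt k (T ─ w₁ ─ w₂)))
          ≡⟨ parity-consecutive-* k (linExt k (T ─ w₁ ─ w₂)) ⟩
        0ℙ ∎
        where open ≡-Reasoning

      isolated-after-pair : ∀ S x y w → onlyBelow? S x w ≡ true → w ≢ y → Isolated (S ─ x ─ y) w
      isolated-after-pair S x y w only w≢y = ∈-─⁺ (S ─ x) y (onlyBelow⇒∈─ S x w only) w≢y , λ z z∈ →
        let z∈S─x = ∈-─⁻ (S ─ x) y z∈
        in ¬-not (λ z<w → ∈-─⇒≢ S x z∈S─x (onlyBelow⇒unique S x w only (∈-─⁻ S x z∈S─x) z<w)) ,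
           ¬-not (λ w<z → height2 (onlyBelow⇒lt S x w only) w<z)

      linExt-after-pair-swap : ∀ k S x y₁ y₂ → onlyBelow? S x y₁ ≡ true → onlyBelow? S x y₂ ≡ true → y₂ ≢ y₁ →
        ∣ S ∣ ≡ suc (suc k) → linExt k (S ─ x ─ y₁) ≡ linExt k (S ─ x ─ y₂)
      linExt-after-pair-swap zero _ _ _ _ _ _ _ _ = refl
      linExt-after-pair-swap (suc k) S x y₁ y₂ only₁ only₂ y₂≢y₁ ∣S∣ = begin
        linExt (suc k) (S ─ x ─ y₁)
          ≡⟨ linExt-isolated k _ y₂ (isolated-after-pair S x y₁ y₂ only₂ y₂≢y₁)
                               (onlyBelow⇒∣──∣ S x y₁ only₁ ∣S∣) ⟩
        suc k * linExt k (S ─ x ─ y₁ ─ y₂)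
          ≡⟨ cong (suc k *_) (linExt-cong k (─-comm (S ─ x) y₁ y₂)) ⟩
        suc k * linExt k (S ─ x ─ y₂ ─ y₁)
          ≡⟨ linExt-isolated k _ y₁ (isolated-after-pair S x y₂ y₁ only₁ (y₂≢y₁ ∘ sym))
                               (onlyBelow⇒∣──∣ S x y₂ only₂ ∣S∣) ⟨
        linExt (suc k) (S ─ x ─ y₂) ∎
        where open ≡-Reasoning

      noIsolated-after-pair : ∀ S x y → NoIsolated S → onlyBelow? S x y ≡ true →
        (∀ y′ → onlyBelow? S x y′ ≡ true → y′ ≡ y) → NoIsolated (S ─ x ─ y)
      noIsolated-after-pair S x y noIso only unique u u∈ = neighbour (noIso u u∈S)
        where
        u∈S─x = ∈-─⁻ (S ─ x) y u∈
        u∈S = ∈-─⁻ S x u∈S─x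
        x<y = onlyBelow⇒lt S x y only
        Neighbour = ∃ λ v → v ∈ S ─ x ─ y × (lt v u ≡ true ⊎ lt u v ≡ true)

        -- if x were the only element below u, then u would be another y
        above-x : lt x u ≡ true → Neighbour
        above-x x<u with find (λ v → (S ─ x) v ∧ lt v u)
        ... | inj₁ (v , v-below) = v , ∈-─⁺ (S ─ x) y v∈ v≢y , inj₁ v<u
          where
          v∈ = ∧-conicalˡ ((S ─ x) v) _ v-below
          v<u = ∧-conicalʳ ((S ─ x) v) _ v-below
          v≢y : v ≢ y
          v≢y refl = height2 x<y v<u
        ... | inj₂ none-below = ⊥-elim (∈-─⇒≢ (S ─ x) y u∈ (unique u u-only))
          where
          u-only : onlyBelow? S x u ≡ true
          u-only = cong₂ _∧_ (onlyBelow⇒∈ S x y only) (cong₂ _∧_ x<u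
            (minimal-intro (S ─ x) u u∈S─x (λ v v∈ → subst (λ b → b ∧ lt v u ≡ false) v∈ (none-below v))))

        neighbour : (∃ λ z → z ∈ S × (lt z u ≡ true ⊎ lt u z ≡ true)) → Neighbour
        neighbour (z , z∈S , z~u) with z ≟ x | z ≟ y
        ... | no z≢x | no z≢y = z , ∈-─⁺ (S ─ x) y (∈-─⁺ S x z∈S z≢x) z≢y , z~u
        ... | yes refl | _ = [ above-x , (λ u<x → ⊥-elim (height2 u<x x<y)) ]′ z~u
        ... | no _ | yes refl = ⊥-elim ([ (λ y<u → height2 x<y y<u)
                                        , (λ u<y → ∈-─⇒≢ S x u∈S─x (onlyBelow⇒unique S x y only u∈S u<y)) ]′ z~u)

      odd-size-even : ∀ j S → ∣ S ∣ ≡ suc (j + j) → NoIsolated S → parity (linExt (suc (j + j)) S) ≡ 0ℙ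
      row-even : ∀ j S x → ∣ S ∣ ≡ suc (suc (suc (j + j))) → NoIsolated S →
        parity (sum (λ y → 𝟙 (onlyBelow? S x y) * linExt (suc (j + j)) (S ─ x ─ y))) ≡ 0ℙ

      odd-size-even zero S ∣S∣ noIso
        with w , w∈S ← ∣∣≡suc⇒nonempty S ∣S∣
        with z , z∈S , z~w ← noIso w w∈S
        with refl ← ∣∣≡1⇒≡ S ∣S∣ w∈S z∈S
        = ⊥-elim ([ (λ w<w → lt⇒≢ w<w refl) , (λ w<w → lt⇒≢ w<w refl) ]′ z~w)
      odd-size-even (suc j) S ∣S∣ noIso =
        subst (λ m → parity (linExt (suc (suc m)) S) ≡ 0ℙ) (sym (+-suc j j))
          (trans (linExt-parity (suc (j + j)) S) (parity-sum-even _ (λ x → row-even j S x ∣S∣′ noIso)))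
        where ∣S∣′ = trans ∣S∣ (cong (λ m → suc (suc m)) (+-suc j j))

      row-even j S x ∣S∣ noIso with census (onlyBelow? S x)
      ... | no-element none = cong parity
            (trans (sum-cong-≗ λ y → cong (λ b → 𝟙 b * L y) (none y)) (sum-replicate-zero n))
        where L = λ y → linExt (suc (j + j)) (S ─ x ─ y)
      ... | one-element y only unique = trans (cong parity (sum-𝟙-only (onlyBelow? S x) y L only unique))
            (odd-size-even j (S ─ x ─ y) (onlyBelow⇒∣──∣ S x y only ∣S∣)
                           (noIsolated-after-pair S x y noIso only unique))
        where L = λ y → linExt (suc (j + j)) (S ─ x ─ y)
      ... | two-elements y₁ y₂ only₁ y₂∈ unique = begin
        parity (sum (λ y → 𝟙 (onlyBelow? S x y) * L y))
          ≡⟨ cong parity (sum-𝟙-split (onlyBelow? S x) y₁ L) ⟩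
        parity (𝟙 (onlyBelow? S x y₁) * L y₁ + sum (λ y → 𝟙 ((onlyBelow? S x ─ y₁) y) * L y))
          ≡⟨ cong parity (cong₂ _+_ (trans (cong (λ b → 𝟙 b * L y₁) only₁) (*-identityˡ _))
                                    (sum-𝟙-only (onlyBelow? S x ─ y₁) y₂ L y₂∈ unique)) ⟩
        parity (L y₁ + L y₂)
          ≡⟨ cong (λ m → parity (L y₁ + m)) (sym (linExt-after-pair-swap _ S x y₁ y₂ only₁ only₂ y₂≢y₁ ∣S∣)) ⟩
        parity (L y₁ + L y₁)
          ≡⟨ parity-double (L y₁) ⟩
        0ℙ ∎
        where
        open ≡-Reasoning
        L = λ y → linExt (suc (j + j)) (S ─ x ─ y)
        only₂ = ∈-─⁻ (onlyBelow? S x) y₁ y₂∈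
        y₂≢y₁ = ∈-─⇒≢ (onlyBelow? S x) y₁ y₂∈
      ... | three-or-more y₁ y₂ y₃ only₁ y₂∈ y₃∈ =
        parity-sum-even _ λ y → parity-𝟙*-even (onlyBelow? S x y) (L y) (even y)
        where
        L = λ y → linExt (suc (j + j)) (S ─ x ─ y)
        y₂∈p = ∈-─⁻ (onlyBelow? S x) y₁ y₂∈
        y₃∈p─y₁ = ∈-─⁻ (onlyBelow? S x ─ y₁) y₂ y₃∈
        y₃∈p = ∈-─⁻ (onlyBelow? S x) y₁ y₃∈p─y₁
        y₂≢y₁ = ∈-─⇒≢ (onlyBelow? S x) y₁ y₂∈
        y₃≢y₁ = ∈-─⇒≢ (onlyBelow? S x) y₁ y₃∈p─y₁
        y₃≢y₂ = ∈-─⇒≢ (onlyBelow? S x ─ y₁) y₂ y₃∈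
        -- removing x and y leaves at least two of y₁, y₂, y₃ isolated
        two-isolated : ∀ y → onlyBelow? S x y ≡ true → ∀ w₁ w₂ → onlyBelow? S x w₁ ≡ true →
          onlyBelow? S x w₂ ≡ true → w₁ ≢ y → w₂ ≢ y → w₂ ≢ w₁ → parity (L y) ≡ 0ℙ
        two-isolated y only w₁ w₂ o₁ o₂ w₁≢y w₂≢y w₂≢w₁ = two-isolated-even _ (S ─ x ─ y) w₁ w₂
          (isolated-after-pair S x y w₁ o₁ w₁≢y) (isolated-after-pair S x y w₂ o₂ w₂≢y) w₂≢w₁
          (onlyBelow⇒∣──∣ S x y only ∣S∣)
        even : ∀ y → onlyBelow? S x y ≡ true → parity (L y) ≡ 0ℙ
        even y only with y ≟ y₁ | y ≟ y₂
        ... | yes refl | _ = two-isolated y only y₂ y₃ y₂∈p y₃∈p y₂≢y₁ y₃≢y₁ y₃≢y₂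
        ... | no y≢y₁ | yes refl = two-isolated y only y₁ y₃ only₁ y₃∈p (y₂≢y₁ ∘ sym) y₃≢y₂ y₃≢y₁
        ... | no y≢y₁ | no y≢y₂ = two-isolated y only y₁ y₂ only₁ y₂∈p (y≢y₁ ∘ sym) (y≢y₂ ∘ sym) y₂≢y₁

      layers-bound : ∀ k S → ∣ S ∣ ≡ k → ∃₂ λ a b → a + b ≡ k × a ! * b ! ≤ linExt k S
      layers-bound k S ∣S∣ = a , k ∸ a , a+b≡k ,
        subst (λ m → a ! * (k ∸ a) ! ≤ linExt m S) a+b≡k
          (linExt-layers a (k ∸ a) S (minimal? S) (trans ∣S∣ (sym a+b≡k)) refl (λ _ min → min) upper-antichain)
        where
        a = ∣ minimal? S ∣
        a+b≡k = m+[n∸m]≡n (subst (a ≤_) ∣S∣ (⊆⇒∣∣≤ (minimal⇒∈ S)))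
        upper-antichain : ∀ u v → u ∈ S → minimal? S u ≡ false → v ∈ S → minimal? S v ≡ false → lt u v ≡ false
        upper-antichain u v u∈S ¬min _ _ with lt u v in u<v | ¬minimal⇒below S u u∈S ¬min
        ... | false | _ = refl
        ... | true | y , _ , y<u = ⊥-elim (height2 y<u u<v)

  isolated⇒∣ : ∀ k S w → Isolated S w → ∣ S ∣ ≡ k → k ∣ linExt k S
  isolated⇒∣ k S w iso refl = subst (λ m → m ∣ linExt m S) (sym ∣S∣)
    (subst (suc (∣ S ─ w ∣) ∣_) (sym (linExt-isolated _ S w iso ∣S∣)) (m∣m*n _))
    where ∣S∣ = ∣─∣ S w (proj₁ iso)

-- Arithmetic of (10!)² − 1

target : ℕ
target = 10 ! * 10 ! ∸ 1

parity-odd : ∀ {m} h → m ≡ suc (h + h) → parity m ≡ 1ℙ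
parity-odd h refl = begin
  parity (suc (h + h))             ≡⟨ ⁻¹-involutive _ ⟨
  parity (suc (h + h)) ℙ.⁻¹ ℙ.⁻¹   ≡⟨ cong ℙ._⁻¹ (suc-homo-⁻¹ (h + h)) ⟩
  parity (h + h) ℙ.⁻¹              ≡⟨ cong ℙ._⁻¹ (parity-double h) ⟩
  1ℙ                               ∎
  where open ≡-Reasoning

-- Computing parity target directly would unfold parity on a unary numeral.
target-odd : parity target ≡ 1ℙ
target-odd = parity-odd {target} 6584094719999 refl

!-mono : ∀ {a b} → a ≤ b → a ! ≤ b !
!-mono {a} {b} a≤b = ∣⇒≤ {{b !≢0}} (m≤n⇒m!∣n! a≤b)

-- Opaque, so that unification never evaluates these decision procedures.
opaque
  15!<target : 15 ! < target
  15!<target = from-yes (15 ! <? target)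

  target<10!² : target < 10 ! * 10 !
  target<10!² = from-yes (target <? 10 ! * 10 !)

  no-divisor-16-19 : ∀ {m} → m < 20 → 16 ≤ m → ¬ m ∣ target
  no-divisor-16-19 = from-yes (allUpTo? (λ m → 16 ≤? m →-dec ¬? (m ∣? target)) 20)

  10!²≤a![20-a]! : ∀ {a} → a < 10 → 10 ! * 10 ! ≤ a ! * (20 ∸ a) !
  10!²≤a![20-a]! = from-yes (allUpTo? (λ a → 10 ! * 10 ! ≤? a ! * (20 ∸ a) !) 10)

  odd-or-small-factorial : ∀ {n} → n < 20 → (∃ λ j → n ≡ suc (j + j)) ⊎ n ! < 2 ^ ⌊ n /2⌋ * target
  odd-or-small-factorial {n} n<20 = ⊎-map (⌊ n /2⌋ ,_) id (cases n<20)
    where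
    cases : ∀ {n} → n < 20 → n ≡ suc (⌊ n /2⌋ + ⌊ n /2⌋) ⊎ n ! < 2 ^ ⌊ n /2⌋ * target
    cases = from-yes (allUpTo? (λ n → (n ≡ᵈ suc (⌊ n /2⌋ + ⌊ n /2⌋)) ⊎-dec (n ! <? 2 ^ ⌊ n /2⌋ * target)) 20)

10!²≤a!b! : ∀ a b → 20 ≤ a + b → 10 ! * 10 ! ≤ a ! * b !
10!²≤a!b! a b 20≤a+b with 10 ≤? a | 10 ≤? b
... | yes 10≤a | yes 10≤b = *-mono-≤ (!-mono 10≤a) (!-mono 10≤b)
... | no a<10 | _ = ≤-trans (10!²≤a![20-a]! (≰⇒> a<10)) (*-monoʳ-≤ (a !) (!-mono (m≤n+o⇒m∸n≤o 20 a 20≤a+b)))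
... | yes _ | no b<10 = begin
  10 ! * 10 !        ≤⟨ 10!²≤a![20-a]! (≰⇒> b<10) ⟩
  b ! * (20 ∸ b) !   ≤⟨ *-monoʳ-≤ (b !) (!-mono (m≤n+o⇒m∸n≤o 20 b (subst (20 ≤_) (+-comm a b) 20≤a+b))) ⟩
  b ! * a !          ≡⟨ *-comm (b !) (a !) ⟩
  a ! * b !          ∎
  where open ≤-Reasoning

mainTheorem9 : (n : ℕ) (lt : Fin n → Fin n → Bool) → IsStrictPoset n lt →
    HeightAtMost2 n lt → ¬ (numLinExt n lt ≡ (10 !) * (10 !) ∸ 1)
mainTheorem9 n lt poset height e≡target = impossible (20 ≤? n) (isolated-or-not full)
  where
  open Extensions lt
  open Strict (λ x → ¬-not λ x<x → IsStrictPoset.irrefl poset x (≡true⇒T x<x))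
  open HeightTwo (λ x<y y<z → height _ _ _ (≡true⇒T x<y) (≡true⇒T y<z))
  ∣full∣≡n : ∣ full {n} ∣ ≡ n
  ∣full∣≡n = ∣full∣
  e≡ : linExt n full ≡ target
  e≡ = trans (sym numLinExt≡linExt) e≡target
  e-odd : parity (linExt n full) ≡ 1ℙ
  e-odd = trans (cong parity e≡) target-odd
  impossible : Dec (20 ≤ n) → (∃ λ w → Isolated full w) ⊎ NoIsolated full → ⊥
  impossible (yes 20≤n) _ with a , b , a+b≡n , a!b!≤e ← layers-bound n full ∣full∣≡n =
    <⇒≱ target<10!² (≤-trans (10!²≤a!b! a b (subst (20 ≤_) (sym a+b≡n) 20≤n)) (subst (a ! * b ! ≤_) e≡ a!b!≤e))
  impossible (no n≱20) (inj₁ (w , iso)) with 16 ≤? n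
  ... | yes 16≤n = no-divisor-16-19 (≰⇒> n≱20) 16≤n (subst (n ∣_) e≡ (isolated⇒∣ n full w iso ∣full∣≡n))
  ... | no n≱16 = <⇒≱ 15!<target
          (subst (_≤ 15 !) e≡ (≤-trans (linExt≤! n full ∣full∣≡n) (!-mono (≤-pred (≰⇒> n≱16)))))
  impossible (no n≱20) (inj₂ no-isolated) with odd-or-small-factorial (≰⇒> n≱20)
  ... | inj₁ (j , refl) = ℙ.p≢p⁻¹ 0ℙ (trans (sym (odd-size-even j full ∣full∣≡n no-isolated)) e-odd)
  ... | inj₂ n!<2^j*e = <⇒≱ n!<2^j*e (subst (λ m → 2 ^ ⌊ n /2⌋ * m ≤ n !) e≡
          (matching-bound (odd⇒matching n full ∣full∣≡n e-odd) ∣full∣≡n))
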